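{- For nonnegative integers $n,m$, \[ \sum_{r=0}^n \sum_{s=0}^m \mathcal{K}_{n,m;r,s}(z,w;q)\,\Phi_{r,s}(1,1;z,w;q)=\Phi_{n,m}(1,1;z,w;q) \] and \[ \sum_{r=0}^n \sum_{s=0}^m \mathcal{K}_{n,m;r,s}(z/q,w;q)\,\Phi_{r,s}(u,v;z,w;q)=\Phi_{n,m}(uz,vw;z,w;q). \]
   Context: $u,v,z,w,q$ are indeterminates. $(a;q)_n=\prod_{j=0}^{n-1}(1-aq^j)$ for $n\geq0$, $(a_1,\dots,a_k;q)_n=\prod_i(a_i;q)_n$, and $1/(q;q)_n:=0$ for $n<0$. For integers $n,m$: $\Phi_{n,m}(z,w;q):=\frac{(zwq;q)_{n+m}}{(q,zq,zwq;q)_n(q,wq,zwq;q)_m}$ if $n,m\geq0$ and $0$ otherwise; $\Phi_{n,m}(u,v;z,w;q):=\Phi_{n,m}(z/q,w;q)-\frac{uz}{(z;q)_2}\Phi_{n-1,m}(zq,w/q;q)+\frac{uvzw^2}{(w,zw;q)_2}\Phi_{n-1,m-1}(z,wq;q)$; $\mathcal{K}_{n,m;r,s}(z,w;q):=\frac{z^rw^sq^{r^2-rs+s^2}}{(q;q)_{n-r}(q;q)_{m-s}}$. -}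

module Defs where

open import Level using (Level; _⊔_) renaming (suc to lsuc)
open import Data.Nat using (ℕ; zero; suc; _∸_) renaming (_+_ to _+ℕ_; _*_ to _*ℕ_)
open import Relation.Nullary using (¬_)
open import Algebra.Bundles using (CommutativeRing)

record Field (c ℓ : Level) : Set (lsuc (c ⊔ ℓ)) where
  field
    commutativeRing : CommutativeRing c ℓ
  open CommutativeRing commutativeRing public
  infix 8 _⁻¹
  field
    _⁻¹       : Carrier → Carrier
    ⁻¹-inverse : ∀ x → ¬ (x ≈ 0#) → x * (x ⁻¹) ≈ 1#
    0≉1        : ¬ (0# ≈ 1#)

module FieldDefs {c ℓ : Level} (F : Field c ℓ) where
  open Field F

  infixl 7 _/_
  _/_ : Carrier → Carrier → Carrier
  x / y = x * (y ⁻¹)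

  infixr 8 _^_
  _^_ : Carrier → ℕ → Carrier
  x ^ zero  = 1#
  x ^ suc n = x * (x ^ n)

  poch : Carrier → Carrier → ℕ → Carrier
  poch a q zero    = 1#
  poch a q (suc n) = poch a q n * (1# - a * q ^ n)

  sumTo : ℕ → (ℕ → Carrier) → Carrier
  sumTo zero    f = f 0
  sumTo (suc n) f = sumTo n f + f (suc n)

  Φ : Carrier → Carrier → Carrier → ℕ → ℕ → Carrier
  Φ z w q n m =
    poch (z * w * q) q (n +ℕ m)
      / ((poch q q n * poch (z * q) q n * poch (z * w * q) q n)
         * (poch q q m * poch (w * q) q m * poch (z * w * q) q m))

  -- Φ_{n-1,m}(z,w;q), which is 0 when n-1 < 0
  Φ↓₁ : Carrier → Carrier → Carrier → ℕ → ℕ → Carrier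
  Φ↓₁ z w q zero    m = 0#
  Φ↓₁ z w q (suc n) m = Φ z w q n m

  -- Φ_{n-1,m-1}(z,w;q), which is 0 when n-1 < 0 or m-1 < 0
  Φ↓₂ : Carrier → Carrier → Carrier → ℕ → ℕ → Carrier
  Φ↓₂ z w q zero    m       = 0#
  Φ↓₂ z w q (suc n) zero    = 0#
  Φ↓₂ z w q (suc n) (suc m) = Φ z w q n m

  Φuv : Carrier → Carrier → Carrier → Carrier → Carrier → ℕ → ℕ → Carrier
  Φuv u v z w q n m =
    Φ (z / q) w q n m
    - ((u * z) / poch z q 2) * Φ↓₁ (z * q) (w / q) q n m
    + ((u * v * z * w ^ 2) / (poch w q 2 * poch (z * w) q 2)) * Φ↓₂ z (w * q) q n m

  -- 𝒦_{n,m;r,s}(z,w;q) = z^r w^s q^{r²-rs+s²} / ((q;q)_{n-r} (q;q)_{m-s}),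
  -- used only for 0 ≤ r ≤ n, 0 ≤ s ≤ m (r²-rs+s² ≥ 0 always).
  𝒦 : Carrier → Carrier → Carrier → ℕ → ℕ → ℕ → ℕ → Carrier
  𝒦 z w q n m r s =
    (z ^ r * w ^ s * q ^ ((r *ℕ r +ℕ s *ℕ s) ∸ r *ℕ s))
      / (poch q q (n ∸ r) * poch q q (m ∸ s))

-- Write T(n,m;r,s) = 𝒦_{n,m;r,s}(z,w;q) Φ_{r,s}(z,w;q). The heart of the matter is
-- Σ_{r≤n,s≤m} T(n,m;r,s) = Φ_{n,m}(z,w;q). For fixed m this goes by induction on n: both
-- sides satisfy X(n+1) P_n = X(n) Q_{n,m}, with P_n = (1−q^{n+1})(1−zq^{n+1})(1−zwq^{n+1}) and
-- Q_{n,m} = 1−zwq^{n+m+1}. For Φ this is immediate; for the sum, rewrite T(n,…) through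
-- T(n+1,…) and split each summand of the difference as (A − B) + (C − D), where A − B
-- telescopes to zero in r and C − D in s (a WZ-style certificate). The start n = 0 is the
-- case m = 0 with z and w exchanged.
--
-- Contiguous relations express Φ(z/q,w), Φ(zq,w/q) and Φ(z,wq) through Φ(z,w); at u = v = 1
-- they give Φ_{n,m}(1,1;z,w;q) = Φ_{n,m}(z,w;q), hence the first identity. For the second,
-- 𝒦_{n+1,m;r+1,s}(z/q,w) = z 𝒦_{n,m;r,s}(zq,w/q) and 𝒦_{n+1,m+1;r+1,s+1}(z/q,w) = zw 𝒦_{n,m;r,s}(z,wq),
-- so by linearity each of the three terms of Φ(u,v;z,w;q) is summed by the first fact at
-- shifted parameters.
-- The hypothesis on 1 − z^a w^b q^j keeps every denominator that occurs invertible.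

module Submission where

open import Defs
open import Level using (Level)
open import Data.Nat using (ℕ; _<_) renaming (_+_ to _+ℕ_)
open import Data.Product using (_×_; _,_)
open import Relation.Nullary using (¬_)
open import Algebra.Bundles using (CommutativeRing)

module IntegerRingSolver {c ℓ} (R : CommutativeRing c ℓ) where

  open import Data.Nat.Base as ℕ using (ℕ; zero; suc)
  open import Data.Integer.Base as ℤ using (ℤ; +_; -[1+_]; _⊖_)
  import Data.Integer.Properties as ℤ
  import Data.Nat.Properties as ℕₚ
  open import Data.Sign.Base as Sign using (Sign)
  open import Data.Maybe.Base using (Maybe; just; nothing)
  open import Relation.Binary.PropositionalEquality.Core as ≡ using (_≡_)
  open import Relation.Nullary.Decidable.Core using (yes; no)
  open import Algebra.Solver.Ring.AlmostCommutativeRing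
    using (fromCommutativeRing; _-Raw-AlmostCommutative⟶_)

  open CommutativeRing R
  open import Algebra.Properties.Ring ring
    using (-‿involutive; -0#≈0#; -‿distribʳ-*; -‿+-comm; -1*x≈-x)
  open import Algebra.Properties.CommutativeSemigroup *-commutativeSemigroup
    using (interchange)
  open import Algebra.Properties.Semiring.Mult.TCOptimised semiring
    using (×-homo-+; ×1-homo-*) renaming (_×_ to _·_)
  open import Relation.Binary.Reasoning.Setoid setoid

  ⟦_⟧ℤ : ℤ → Carrier
  ⟦ + n ⟧ℤ = n · 1#
  ⟦ -[1+ n ] ⟧ℤ = - (suc n · 1#)

  private
    suc·1# : ∀ n → suc n · 1# ≈ 1# + n · 1#
    suc·1# n = ×-homo-+ 1# 1 n

    1+a-[1+b]≈a-b : ∀ a b → (1# + a) - (1# + b) ≈ a - b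
    1+a-[1+b]≈a-b a b = begin
      (1# + a) - (1# + b)      ≈⟨ +-congˡ (-‿+-comm 1# b) ⟨
      (1# + a) + (- 1# - b)    ≈⟨ +-congʳ (+-comm 1# a) ⟩
      (a + 1#) + (- 1# - b)    ≈⟨ +-assoc a 1# _ ⟩
      a + (1# + (- 1# - b))    ≈⟨ +-congˡ (+-assoc 1# (- 1#) (- b)) ⟨
      a + ((1# - 1#) - b)      ≈⟨ +-congˡ (+-congʳ (-‿inverseʳ 1#)) ⟩
      a + (0# - b)             ≈⟨ +-congˡ (+-identityˡ (- b)) ⟩
      a - b                    ∎

    ⊖-homo : ∀ m n → ⟦ m ⊖ n ⟧ℤ ≈ m · 1# - n · 1#
    ⊖-homo zero    zero    = sym (-‿inverseʳ 0#)
    ⊖-homo (suc m) zero    = sym (trans (+-congˡ -0#≈0#) (+-identityʳ _))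
    ⊖-homo zero    (suc n) = sym (+-identityˡ _)
    ⊖-homo (suc m) (suc n) = begin
      ⟦ suc m ⊖ suc n ⟧ℤ              ≡⟨ ≡.cong ⟦_⟧ℤ (ℤ.[1+m]⊖[1+n]≡m⊖n m n) ⟩
      ⟦ m ⊖ n ⟧ℤ                      ≈⟨ ⊖-homo m n ⟩
      m · 1# - n · 1#                 ≈⟨ 1+a-[1+b]≈a-b _ _ ⟨
      (1# + m · 1#) - (1# + n · 1#)   ≈⟨ +-cong (suc·1# m) (-‿cong (suc·1# n)) ⟨
      suc m · 1# - suc n · 1#         ∎

    +-homo : ∀ i j → ⟦ i ℤ.+ j ⟧ℤ ≈ ⟦ i ⟧ℤ + ⟦ j ⟧ℤ
    +-homo (+ m)    (+ n)    = ×-homo-+ 1# m n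
    +-homo (+ m)    -[1+ n ] = ⊖-homo m (suc n)
    +-homo -[1+ m ] (+ n)    = trans (⊖-homo n (suc m)) (+-comm _ _)
    +-homo -[1+ m ] -[1+ n ] = begin
      - (suc (suc (m ℕ.+ n)) · 1#)          ≡⟨ ≡.cong (λ k → - (suc k · 1#)) (ℕₚ.+-suc m n) ⟨
      - ((suc m ℕ.+ suc n) · 1#)            ≈⟨ -‿cong (×-homo-+ 1# (suc m) (suc n)) ⟩
      - (suc m · 1# + suc n · 1#)           ≈⟨ -‿+-comm _ _ ⟨
      - (suc m · 1#) + - (suc n · 1#)       ∎

    -‿homo : ∀ i → ⟦ ℤ.- i ⟧ℤ ≈ - ⟦ i ⟧ℤ
    -‿homo -[1+ n ]    = sym (-‿involutive _)
    -‿homo (+ zero)    = sym -0#≈0#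
    -‿homo (+ (suc n)) = refl

    ⟦_⟧S : Sign → Carrier
    ⟦ Sign.+ ⟧S = 1#
    ⟦ Sign.- ⟧S = - 1#

    ◃-homo : ∀ s n → ⟦ s ℤ.◃ n ⟧ℤ ≈ ⟦ s ⟧S * n · 1#
    ◃-homo s       zero    = sym (zeroʳ _)
    ◃-homo Sign.+ (suc n) = sym (*-identityˡ _)
    ◃-homo Sign.- (suc n) = sym (-1*x≈-x _)

    sign-abs : ∀ i → ⟦ i ⟧ℤ ≈ ⟦ ℤ.sign i ⟧S * ℤ.∣ i ∣ · 1#
    sign-abs i = trans (≡.subst (λ j → ⟦ i ⟧ℤ ≈ ⟦ j ⟧ℤ) (≡.sym (ℤ.◃-inverse i)) refl)
                       (◃-homo (ℤ.sign i) ℤ.∣ i ∣)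

    sign-*-homo : ∀ s t → ⟦ s Sign.* t ⟧S ≈ ⟦ s ⟧S * ⟦ t ⟧S
    sign-*-homo Sign.+ t       = sym (*-identityˡ _)
    sign-*-homo Sign.- Sign.+ = sym (*-identityʳ _)
    sign-*-homo Sign.- Sign.- = begin
      1#             ≈⟨ -‿involutive 1# ⟨
      - - 1#         ≈⟨ -‿cong (-1*x≈-x 1#) ⟨
      - (- 1# * 1#)  ≈⟨ -‿distribʳ-* (- 1#) 1# ⟩
      - 1# * - 1#    ∎

    *-homo : ∀ i j → ⟦ i ℤ.* j ⟧ℤ ≈ ⟦ i ⟧ℤ * ⟦ j ⟧ℤ
    *-homo i j = begin
      ⟦ i ℤ.* j ⟧ℤ
        ≈⟨ ◃-homo (ℤ.sign i Sign.* ℤ.sign j) (ℤ.∣ i ∣ ℕ.* ℤ.∣ j ∣) ⟩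
      ⟦ ℤ.sign i Sign.* ℤ.sign j ⟧S * (ℤ.∣ i ∣ ℕ.* ℤ.∣ j ∣) · 1#
        ≈⟨ *-cong (sign-*-homo (ℤ.sign i) (ℤ.sign j)) (×1-homo-* ℤ.∣ i ∣ ℤ.∣ j ∣) ⟩
      (⟦ ℤ.sign i ⟧S * ⟦ ℤ.sign j ⟧S) * (ℤ.∣ i ∣ · 1# * ℤ.∣ j ∣ · 1#)
        ≈⟨ interchange _ _ _ _ ⟩
      (⟦ ℤ.sign i ⟧S * ℤ.∣ i ∣ · 1#) * (⟦ ℤ.sign j ⟧S * ℤ.∣ j ∣ · 1#)
        ≈⟨ *-cong (sign-abs i) (sign-abs j) ⟨
      ⟦ i ⟧ℤ * ⟦ j ⟧ℤ
        ∎

    homomorphism : ℤ.+-*-rawRing -Raw-AlmostCommutative⟶ fromCommutativeRing R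
    homomorphism = record
      { ⟦_⟧ = ⟦_⟧ℤ ; +-homo = +-homo ; *-homo = *-homo ; -‿homo = -‿homo
      ; 0-homo = refl ; 1-homo = refl }

    _≟ℤ_ : ∀ i j → Maybe (⟦ i ⟧ℤ ≈ ⟦ j ⟧ℤ)
    i ≟ℤ j with i ℤ.≟ j
    ... | yes ≡.refl = just refl
    ... | no _       = nothing

  -- With the carrier itself as coefficients the normaliser cannot see that 1# - 1# is 0#;
  -- integer coefficients make equal polynomials have identical normal forms.
  open import Algebra.Solver.Ring ℤ.+-*-rawRing (fromCommutativeRing R) homomorphism _≟ℤ_ public

  𝟙 : ∀ {n} → Polynomial n
  𝟙 = con (+ 1)

  𝟘 : ∀ {n} → Polynomial n
  𝟘 = con (+ 0)

module QuadraticExponent where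

  open import Data.Nat.Base
  open import Data.Nat.Properties
  open import Data.Nat.Tactic.RingSolver using (solve-∀)
  open import Data.Sum.Base using (inj₁; inj₂)
  open import Relation.Binary.PropositionalEquality

  quadratic : ℕ → ℕ → ℕ
  quadratic r s = (r * r + s * s) ∸ r * s

  quadratic-comm : ∀ r s → quadratic r s ≡ quadratic s r
  quadratic-comm r s = cong₂ _∸_ (+-comm (r * r) (s * s)) (*-comm r s)

  private
    r*s≤r*r+s*s : ∀ r s → r * s ≤ r * r + s * s
    r*s≤r*r+s*s r s with ≤-total r s
    ... | inj₁ r≤s = ≤-trans (*-monoˡ-≤ s r≤s) (m≤n+m (s * s) (r * r))
    ... | inj₂ s≤r = ≤-trans (*-monoʳ-≤ r s≤r) (m≤m+n (r * r) (s * s))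

    quadratic+r*s : ∀ r s → quadratic r s + r * s ≡ r * r + s * s
    quadratic+r*s r s = m∸n+n≡m (r*s≤r*r+s*s r s)

    shuffle : ∀ a b c d → a + b + (c + d) ≡ a + c + b + d
    shuffle = solve-∀

    -- Both sides are compared after adding r * s + r′ * s′, so that no truncated subtraction remains.
    quadratic-shift : ∀ r s r′ s′ {x y} →
      r′ * r′ + s′ * s′ + x + r * s ≡ r * r + s * s + y + r′ * s′ →
      quadratic r′ s′ + x ≡ quadratic r s + y
    quadratic-shift r s r′ s′ {x} {y} eq = +-cancelʳ-≡ (r′ * s′ + r * s) _ _ (begin
      quadratic r′ s′ + x + (r′ * s′ + r * s)     ≡⟨ shuffle (quadratic r′ s′) x (r′ * s′) (r * s) ⟩
      quadratic r′ s′ + r′ * s′ + x + r * s       ≡⟨ cong (λ k → k + x + r * s) (quadratic+r*s r′ s′) ⟩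
      r′ * r′ + s′ * s′ + x + r * s               ≡⟨ eq ⟩
      r * r + s * s + y + r′ * s′                 ≡⟨ cong (λ k → k + y + r′ * s′) (quadratic+r*s r s) ⟨
      quadratic r s + r * s + y + r′ * s′         ≡⟨ shuffle (quadratic r s) y (r * s) (r′ * s′) ⟨
      quadratic r s + y + (r * s + r′ * s′)       ≡⟨ cong (quadratic r s + y +_) (+-comm (r * s) _) ⟩
      quadratic r s + y + (r′ * s′ + r * s)       ∎)
      where open ≡-Reasoning

  quadratic-sucˡ : ∀ r s → quadratic (suc r) s + s ≡ quadratic r s + suc (r + r)
  quadratic-sucˡ r s = quadratic-shift r s (suc r) s (lemma r s)
    where
    lemma : ∀ r s → suc r * suc r + s * s + s + r * s ≡ r * r + s * s + suc (r + r) + suc r * s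
    lemma = solve-∀

  quadratic-sucʳ : ∀ r s → quadratic r (suc s) + r ≡ quadratic r s + suc (s + s)
  quadratic-sucʳ r s = quadratic-shift r s r (suc s) (lemma r s)
    where
    lemma : ∀ r s → r * r + suc s * suc s + r + r * s ≡ r * r + s * s + suc (s + s) + r * suc s
    lemma = solve-∀

  quadratic-suc : ∀ r s → quadratic (suc r) (suc s) ≡ quadratic r s + suc (r + s)
  quadratic-suc r s = trans (sym (+-identityʳ _)) (quadratic-shift r s (suc r) (suc s) (lemma r s))
    where
    lemma : ∀ r s → suc r * suc r + suc s * suc s + 0 + r * s ≡ r * r + s * s + suc (r + s) + suc r * suc s
    lemma = solve-∀

module FieldProperties {c ℓ} (F : Field c ℓ) where

  open import Data.Nat.Base as ℕ using (ℕ; zero; suc; _≤_; _<_; z≤n)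
  import Data.Nat.Properties as ℕ
  open Field F hiding (zero)
  open FieldDefs F
  open import Algebra.Properties.Ring ring using (-‿+-comm)
  open import Relation.Binary.Reasoning.Setoid setoid
  open IntegerRingSolver commutativeRing using (solve; _:=_; _:*_)

  NonZero : Carrier → Set ℓ
  NonZero x = ¬ (x ≈ 0#)

  1≉0 : NonZero 1#
  1≉0 1≈0 = 0≉1 (sym 1≈0)

  ≈-nonZero : ∀ {x y} → x ≈ y → NonZero x → NonZero y
  ≈-nonZero x≈y x≉0 y≈0 = x≉0 (trans x≈y y≈0)

  ⁻¹-inverseʳ : ∀ {x} → NonZero x → x * x ⁻¹ ≈ 1#
  ⁻¹-inverseʳ {x} = ⁻¹-inverse x

  ⁻¹-inverseˡ : ∀ {x} → NonZero x → x ⁻¹ * x ≈ 1#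
  ⁻¹-inverseˡ {x} x≉0 = trans (*-comm _ _) (⁻¹-inverse x x≉0)

  ⁻¹-≈1 : ∀ {x} → x ≈ 1# → x ⁻¹ ≈ 1#
  ⁻¹-≈1 {x} x≈1 = begin
    x ⁻¹        ≈⟨ *-identityˡ _ ⟨
    1# * x ⁻¹   ≈⟨ *-congʳ x≈1 ⟨
    x * x ⁻¹    ≈⟨ ⁻¹-inverse x (≈-nonZero (sym x≈1) 1≉0) ⟩
    1#          ∎

  ≈-*-unit : ∀ {x y u} → u ≈ 1# → x ≈ y * u → x ≈ y
  ≈-*-unit {y = y} u≈1 x≈yu = trans x≈yu (trans (*-congˡ u≈1) (*-identityʳ y))

  *-cancelʳ : ∀ {x y d} → NonZero d → x * d ≈ y * d → x ≈ y
  *-cancelʳ {x} {y} {d} d≉0 xd≈yd = begin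
    x                ≈⟨ *-identityʳ x ⟨
    x * 1#           ≈⟨ *-congˡ (⁻¹-inverse d d≉0) ⟨
    x * (d * d ⁻¹)   ≈⟨ *-assoc x d _ ⟨
    x * d * d ⁻¹     ≈⟨ *-congʳ xd≈yd ⟩
    y * d * d ⁻¹     ≈⟨ *-assoc y d _ ⟩
    y * (d * d ⁻¹)   ≈⟨ *-congˡ (⁻¹-inverse d d≉0) ⟩
    y * 1#           ≈⟨ *-identityʳ y ⟩
    y                ∎

  ⁻¹-cong : ∀ {x y} → NonZero x → x ≈ y → x ⁻¹ ≈ y ⁻¹
  ⁻¹-cong {x} {y} x≉0 x≈y = *-cancelʳ x≉0 (begin
    x ⁻¹ * x   ≈⟨ ⁻¹-inverseˡ x≉0 ⟩
    1#         ≈⟨ ⁻¹-inverseˡ (≈-nonZero x≈y x≉0) ⟨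
    y ⁻¹ * y   ≈⟨ *-congˡ x≈y ⟨
    y ⁻¹ * x   ∎)

  *-nonZero : ∀ {x y} → NonZero x → NonZero y → NonZero (x * y)
  *-nonZero {x} {y} x≉0 y≉0 xy≈0 = x≉0 (*-cancelʳ y≉0 (trans xy≈0 (sym (zeroˡ y))))

  /-*-cancelʳ : ∀ x {y} → NonZero y → x / y * y ≈ x
  /-*-cancelʳ x {y} y≉0 = begin
    x * y ⁻¹ * y     ≈⟨ *-assoc x _ y ⟩
    x * (y ⁻¹ * y)   ≈⟨ *-congˡ (⁻¹-inverseˡ y≉0) ⟩
    x * 1#           ≈⟨ *-identityʳ x ⟩
    x                ∎

  /-*-/-cancel : ∀ a {b} c {d} → NonZero b → NonZero d → a / b * (c / d) * (b * d) ≈ a * c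
  /-*-/-cancel a {b} c {d} b≉0 d≉0 =
    ≈-*-unit (trans (*-cong (⁻¹-inverseʳ b≉0) (⁻¹-inverseʳ d≉0)) (*-identityˡ 1#))
      (solve 6 (λ a b⁻¹ c d⁻¹ b d → a :* b⁻¹ :* (c :* d⁻¹) :* (b :* d) := a :* c :* (b :* b⁻¹ :* (d :* d⁻¹)))
         refl a (b ⁻¹) c (d ⁻¹) b d)

  cross-multiply : ∀ {t₁ d₁ x₁ t₀ d₀ x₀ a b} → NonZero d₁ → NonZero d₀ →
    t₁ * d₁ ≈ x₁ → t₀ * d₀ ≈ x₀ → x₁ * a * d₀ ≈ x₀ * b * d₁ → t₁ * a ≈ t₀ * b
  cross-multiply {t₁} {d₁} {x₁} {t₀} {d₀} {x₀} {a} {b} d₁≉0 d₀≉0 t₁d₁≈x₁ t₀d₀≈x₀ cross =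
    *-cancelʳ (*-nonZero d₁≉0 d₀≉0) (begin
      t₁ * a * (d₁ * d₀)   ≈⟨ solve 4 (λ t a d e → t :* a :* (d :* e) := t :* d :* a :* e) refl t₁ a d₁ d₀ ⟩
      t₁ * d₁ * a * d₀     ≈⟨ *-congʳ (*-congʳ t₁d₁≈x₁) ⟩
      x₁ * a * d₀          ≈⟨ cross ⟩
      x₀ * b * d₁          ≈⟨ *-congʳ (*-congʳ t₀d₀≈x₀) ⟨
      t₀ * d₀ * b * d₁     ≈⟨ solve 4 (λ t b d e → t :* e :* b :* d := t :* b :* (d :* e)) refl t₀ b d₁ d₀ ⟩
      t₀ * b * (d₁ * d₀)   ∎)

  ^-cong : ∀ {x y} n → x ≈ y → x ^ n ≈ y ^ n
  ^-cong zero    x≈y = refl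
  ^-cong (suc n) x≈y = *-cong x≈y (^-cong n x≈y)

  ^-+ : ∀ x m n → x ^ (m ℕ.+ n) ≈ x ^ m * x ^ n
  ^-+ x zero    n = sym (*-identityˡ _)
  ^-+ x (suc m) n = trans (*-congˡ (^-+ x m n)) (sym (*-assoc _ _ _))

  ^-distribʳ-* : ∀ x y n → (x * y) ^ n ≈ x ^ n * y ^ n
  ^-distribʳ-* x y zero    = sym (*-identityˡ 1#)
  ^-distribʳ-* x y (suc n) = trans (*-congˡ (^-distribʳ-* x y n))
    (solve 4 (λ x y a b → x :* y :* (a :* b) := x :* a :* (y :* b)) refl x y (x ^ n) (y ^ n))

  1^n≈1 : ∀ n → 1# ^ n ≈ 1#
  1^n≈1 zero    = refl
  1^n≈1 (suc n) = trans (*-identityˡ _) (1^n≈1 n)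

  ^-nonZero : ∀ {x} n → NonZero x → NonZero (x ^ n)
  ^-nonZero zero    x≉0 = 1≉0
  ^-nonZero (suc n) x≉0 = *-nonZero x≉0 (^-nonZero n x≉0)

  poch-cong : ∀ {a b} q n → a ≈ b → poch a q n ≈ poch b q n
  poch-cong q zero    a≈b = refl
  poch-cong q (suc n) a≈b = *-cong (poch-cong q n a≈b) (+-congˡ (-‿cong (*-congʳ a≈b)))

  poch-nonZero : ∀ a q n → (∀ j → NonZero (1# - a * q ^ j)) → NonZero (poch a q n)
  poch-nonZero a q zero    factors≉0 = 1≉0
  poch-nonZero a q (suc n) factors≉0 = *-nonZero (poch-nonZero a q n factors≉0) (factors≉0 n)

  poch-suc : ∀ a q n → poch a q (suc n) ≈ (1# - a) * poch (a * q) q n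
  poch-suc a q zero = begin
    1# * (1# - a * 1#)   ≈⟨ *-identityˡ _ ⟩
    1# - a * 1#          ≈⟨ +-congˡ (-‿cong (*-identityʳ a)) ⟩
    1# - a               ≈⟨ *-identityʳ _ ⟨
    (1# - a) * 1#        ∎
  poch-suc a q (suc n) = begin
    poch a q (suc n) * (1# - a * (q * q ^ n))
      ≈⟨ *-cong (poch-suc a q n) (+-congˡ (-‿cong (sym (*-assoc a q _)))) ⟩
    (1# - a) * poch (a * q) q n * (1# - a * q * q ^ n)
      ≈⟨ *-assoc _ _ _ ⟩
    (1# - a) * poch (a * q) q (suc n) ∎

  sum-cong : ∀ n {f g : ℕ → Carrier} → (∀ r → r ≤ n → f r ≈ g r) → sumTo n f ≈ sumTo n g
  sum-cong zero    f≈g = f≈g 0 z≤n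
  sum-cong (suc n) f≈g =
    +-cong (sum-cong n (λ r r≤n → f≈g r (ℕ.m≤n⇒m≤1+n r≤n))) (f≈g (suc n) ℕ.≤-refl)

  sum-zero : ∀ n {f : ℕ → Carrier} → (∀ r → r ≤ n → f r ≈ 0#) → sumTo n f ≈ 0#
  sum-zero zero    f≈0 = f≈0 0 z≤n
  sum-zero (suc n) f≈0 =
    trans (+-cong (sum-zero n (λ r r≤n → f≈0 r (ℕ.m≤n⇒m≤1+n r≤n))) (f≈0 (suc n) ℕ.≤-refl))
          (+-identityˡ 0#)

  sum-+ : ∀ n (f g : ℕ → Carrier) → sumTo n (λ r → f r + g r) ≈ sumTo n f + sumTo n g
  sum-+ zero    f g = refl
  sum-+ (suc n) f g = trans (+-congʳ (sum-+ n f g)) (interchange _ _ _ _)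
    where open import Algebra.Properties.CommutativeSemigroup +-commutativeSemigroup using (interchange)

  sum-neg : ∀ n (f : ℕ → Carrier) → sumTo n (λ r → - f r) ≈ - sumTo n f
  sum-neg zero    f = refl
  sum-neg (suc n) f = trans (+-congʳ (sum-neg n f)) (-‿+-comm _ _)

  sum-- : ∀ n (f g : ℕ → Carrier) → sumTo n (λ r → f r - g r) ≈ sumTo n f - sumTo n g
  sum-- n f g = trans (sum-+ n f (λ r → - g r)) (+-congˡ (sum-neg n g))

  sum-*ˡ : ∀ n a (f : ℕ → Carrier) → sumTo n (λ r → a * f r) ≈ a * sumTo n f
  sum-*ˡ zero    a f = refl
  sum-*ˡ (suc n) a f = trans (+-congʳ (sum-*ˡ n a f)) (sym (distribˡ _ _ _))

  sum-*ʳ : ∀ n a (f : ℕ → Carrier) → sumTo n (λ r → f r * a) ≈ sumTo n f * a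
  sum-*ʳ n a f = begin
    sumTo n (λ r → f r * a)   ≈⟨ sum-cong n (λ r _ → *-comm (f r) a) ⟩
    sumTo n (λ r → a * f r)   ≈⟨ sum-*ˡ n a f ⟩
    a * sumTo n f             ≈⟨ *-comm a _ ⟩
    sumTo n f * a             ∎

  sumTo² : ℕ → ℕ → (ℕ → ℕ → Carrier) → Carrier
  sumTo² n m f = sumTo n (λ r → sumTo m (f r))

  sum-comm : ∀ n m (f : ℕ → ℕ → Carrier) →
    sumTo n (λ r → sumTo m (f r)) ≈ sumTo m (λ s → sumTo n (λ r → f r s))
  sum-comm zero    m f = refl
  sum-comm (suc n) m f = begin
    sumTo n (λ r → sumTo m (f r)) + sumTo m (f (suc n))
      ≈⟨ +-congʳ (sum-comm n m f) ⟩
    sumTo m (λ s → sumTo n (λ r → f r s)) + sumTo m (f (suc n))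
      ≈⟨ sum-+ m _ _ ⟨
    sumTo m (λ s → sumTo (suc n) (λ r → f r s)) ∎

  sum-suc : ∀ n (f : ℕ → Carrier) → sumTo (suc n) f ≈ f 0 + sumTo n (λ r → f (suc r))
  sum-suc zero    f = refl
  sum-suc (suc n) f = trans (+-congʳ (sum-suc n f)) (+-assoc _ _ _)

  sum-telescope : ∀ n (f g : ℕ → Carrier) → (∀ r → r < n → f r ≈ g (suc r)) →
    sumTo n (λ r → f r - g r) ≈ f n - g 0
  sum-telescope zero    f g f≈g = refl
  sum-telescope (suc n) f g f≈g = begin
    sumTo n (λ r → f r - g r) + (f (suc n) - g (suc n))
      ≈⟨ +-congʳ (sum-telescope n f g (λ r r<n → f≈g r (ℕ.m≤n⇒m≤1+n r<n))) ⟩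
    (f n - g 0) + (f (suc n) - g (suc n))
      ≈⟨ +-congʳ (+-congʳ (f≈g n ℕ.≤-refl)) ⟩
    (g (suc n) - g 0) + (f (suc n) - g (suc n))
      ≈⟨ +-comm _ _ ⟩
    (f (suc n) - g (suc n)) + (g (suc n) - g 0)
      ≈⟨ +-assoc _ _ _ ⟩
    f (suc n) + (- g (suc n) + (g (suc n) - g 0))
      ≈⟨ +-congˡ (+-assoc _ _ _) ⟨
    f (suc n) + ((- g (suc n) + g (suc n)) - g 0)
      ≈⟨ +-congˡ (+-congʳ (-‿inverseˡ _)) ⟩
    f (suc n) + (0# - g 0)
      ≈⟨ +-congˡ (+-identityˡ _) ⟩
    f (suc n) - g 0 ∎

  sum-linear : ∀ n (f g h : ℕ → Carrier) a b →
    sumTo n (λ r → f r - a * g r + b * h r) ≈ sumTo n f - a * sumTo n g + b * sumTo n h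
  sum-linear n f g h a b = begin
    sumTo n (λ r → f r - a * g r + b * h r)                    ≈⟨ sum-+ n _ _ ⟩
    sumTo n (λ r → f r - a * g r) + sumTo n (λ r → b * h r)    ≈⟨ +-cong (sum-- n _ _) (sum-*ˡ n b h) ⟩
    sumTo n f - sumTo n (λ r → a * g r) + b * sumTo n h        ≈⟨ +-congʳ (+-congˡ (-‿cong (sum-*ˡ n a g))) ⟩
    sumTo n f - a * sumTo n g + b * sumTo n h                  ∎

  sumTo²-linear : ∀ n m (f g h : ℕ → ℕ → Carrier) a b →
    sumTo² n m (λ r s → f r s - a * g r s + b * h r s) ≈ sumTo² n m f - a * sumTo² n m g + b * sumTo² n m h
  sumTo²-linear n m f g h a b =
    trans (sum-cong n (λ r _ → sum-linear m (f r) (g r) (h r) a b)) (sum-linear n _ _ _ a b)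

  sumTo²-*ˡ : ∀ n m a (f : ℕ → ℕ → Carrier) → sumTo² n m (λ r s → a * f r s) ≈ a * sumTo² n m f
  sumTo²-*ˡ n m a f = trans (sum-cong n (λ r _ → sum-*ˡ m a (f r))) (sum-*ˡ n a _)

module 𝒦ΦSum {c ℓ} (F : Field c ℓ) where

  open import Data.Nat.Base as ℕ using (ℕ; zero; suc; _∸_; _≤_; _<_; s≤s)
  import Data.Nat.Properties as ℕ
  import Relation.Binary.PropositionalEquality as ≡
  open Field F hiding (zero)
  open FieldDefs F
  open import Algebra.Properties.Group +-group using (x∙y⁻¹≈ε⇒x≈y)
  open import Relation.Binary.Reasoning.Setoid setoid
  open IntegerRingSolver commutativeRing using (solve; _:=_; _:*_; _:+_; _:-_; 𝟙; 𝟘)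
  open FieldProperties F
  open QuadraticExponent

  Φnum : Carrier → Carrier → Carrier → ℕ → ℕ → Carrier
  Φnum z w q r s = poch (z * w * q) q (r ℕ.+ s)

  Φden : Carrier → Carrier → Carrier → ℕ → ℕ → Carrier
  Φden z w q r s =
    (poch q q r * poch (z * q) q r * poch (z * w * q) q r)
      * (poch q q s * poch (w * q) q s * poch (z * w * q) q s)

  Φ-*-Φden : ∀ z w q r s → NonZero (Φden z w q r s) → Φ z w q r s * Φden z w q r s ≈ Φnum z w q r s
  Φ-*-Φden z w q r s = /-*-cancelʳ (Φnum z w q r s)

  q^quadratic-sucˡ : ∀ q r s → q ^ quadratic (suc r) s * q ^ s ≈ q ^ quadratic r s * (q * (q ^ r * q ^ r))
  q^quadratic-sucˡ q r s = begin
    q ^ quadratic (suc r) s * q ^ s          ≈⟨ ^-+ q (quadratic (suc r) s) s ⟨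
    q ^ (quadratic (suc r) s ℕ.+ s)          ≡⟨ ≡.cong (q ^_) (quadratic-sucˡ r s) ⟩
    q ^ (quadratic r s ℕ.+ suc (r ℕ.+ r))    ≈⟨ ^-+ q (quadratic r s) (suc (r ℕ.+ r)) ⟩
    q ^ quadratic r s * (q * q ^ (r ℕ.+ r))  ≈⟨ *-congˡ (*-congˡ (^-+ q r r)) ⟩
    q ^ quadratic r s * (q * (q ^ r * q ^ r)) ∎

  q^quadratic-sucʳ : ∀ q r s → q ^ quadratic r (suc s) * q ^ r ≈ q ^ quadratic r s * (q * (q ^ s * q ^ s))
  q^quadratic-sucʳ q r s = begin
    q ^ quadratic r (suc s) * q ^ r          ≈⟨ ^-+ q (quadratic r (suc s)) r ⟨
    q ^ (quadratic r (suc s) ℕ.+ r)          ≡⟨ ≡.cong (q ^_) (quadratic-sucʳ r s) ⟩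
    q ^ (quadratic r s ℕ.+ suc (s ℕ.+ s))    ≈⟨ ^-+ q (quadratic r s) (suc (s ℕ.+ s)) ⟩
    q ^ quadratic r s * (q * q ^ (s ℕ.+ s))  ≈⟨ *-congˡ (*-congˡ (^-+ q s s)) ⟩
    q ^ quadratic r s * (q * (q ^ s * q ^ s)) ∎

  q^quadratic-suc : ∀ q r s → q ^ quadratic (suc r) (suc s) ≈ q ^ quadratic r s * (q * (q ^ r * q ^ s))
  q^quadratic-suc q r s = begin
    q ^ quadratic (suc r) (suc s)            ≡⟨ ≡.cong (q ^_) (quadratic-suc r s) ⟩
    q ^ (quadratic r s ℕ.+ suc (r ℕ.+ s))    ≈⟨ ^-+ q (quadratic r s) (suc (r ℕ.+ s)) ⟩
    q ^ quadratic r s * (q * q ^ (r ℕ.+ s))  ≈⟨ *-congˡ (*-congˡ (^-+ q r s)) ⟩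
    q ^ quadratic r s * (q * (q ^ r * q ^ s)) ∎

  module Recurrence (z w q : Carrier) (q≉0 : NonZero q)
    (1-qqʲ≉0 : ∀ j → NonZero (1# - q * q ^ j))
    (1-zqqʲ≉0 : ∀ j → NonZero (1# - z * q * q ^ j))
    (1-wqqʲ≉0 : ∀ j → NonZero (1# - w * q * q ^ j))
    (1-zwqqʲ≉0 : ∀ j → NonZero (1# - z * w * q * q ^ j)) where

    𝒦Φ : ℕ → ℕ → ℕ → ℕ → Carrier
    𝒦Φ n m r s = 𝒦 z w q n m r s * Φ z w q r s

    𝒦num : ℕ → ℕ → Carrier
    𝒦num r s = z ^ r * w ^ s * q ^ quadratic r s

    𝒦den : ℕ → ℕ → ℕ → ℕ → Carrier
    𝒦den n m r s = poch q q (n ∸ r) * poch q q (m ∸ s)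

    num : ℕ → ℕ → Carrier
    num r s = 𝒦num r s * Φnum z w q r s

    den : ℕ → ℕ → ℕ → ℕ → Carrier
    den n m r s = 𝒦den n m r s * Φden z w q r s

    qʳ≉0 : ∀ r → NonZero (q ^ r)
    qʳ≉0 r = ^-nonZero r q≉0

    poch-q-nonZero : ∀ k → NonZero (poch q q k)
    poch-q-nonZero k = poch-nonZero q q k 1-qqʲ≉0

    Φden-nonZero : ∀ r s → NonZero (Φden z w q r s)
    Φden-nonZero r s =
      *-nonZero (*-nonZero (*-nonZero (poch-q-nonZero r) (poch-nonZero _ q r 1-zqqʲ≉0)) (poch-nonZero _ q r 1-zwqqʲ≉0))
                (*-nonZero (*-nonZero (poch-q-nonZero s) (poch-nonZero _ q s 1-wqqʲ≉0)) (poch-nonZero _ q s 1-zwqqʲ≉0))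

    𝒦den-nonZero : ∀ n m r s → NonZero (𝒦den n m r s)
    𝒦den-nonZero n m r s = *-nonZero (poch-q-nonZero (n ∸ r)) (poch-q-nonZero (m ∸ s))

    den-nonZero : ∀ n m r s → NonZero (den n m r s)
    den-nonZero n m r s = *-nonZero (𝒦den-nonZero n m r s) (Φden-nonZero r s)

    𝒦Φ-*-den : ∀ n m r s → 𝒦Φ n m r s * den n m r s ≈ num r s
    𝒦Φ-*-den n m r s = /-*-/-cancel (𝒦num r s) (Φnum z w q r s) (𝒦den-nonZero n m r s) (Φden-nonZero r s)

    κ : ℕ → ℕ → Carrier
    κ n r = 1# - q * q ^ (n ∸ r)

    poch-q-suc-∸ : ∀ n r → r ≤ n → poch q q (suc n ∸ r) ≈ poch q q (n ∸ r) * κ n r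
    poch-q-suc-∸ n r r≤n = reflexive (≡.cong (poch q q) (ℕ.+-∸-assoc 1 r≤n))

    qʳ-*-κ : ∀ n r → r ≤ n → q ^ r * κ n r ≈ q ^ r - q ^ suc n
    qʳ-*-κ n r r≤n = begin
      q ^ r * (1# - q * q ^ (n ∸ r))
        ≈⟨ solve 3 (λ x q y → x :* (𝟙 :- q :* y) := x :- q :* (x :* y)) refl (q ^ r) q (q ^ (n ∸ r)) ⟩
      q ^ r - q * (q ^ r * q ^ (n ∸ r))
        ≈⟨ +-congˡ (-‿cong (*-congˡ (trans (sym (^-+ q r (n ∸ r))) (reflexive (≡.cong (q ^_) (ℕ.m+[n∸m]≡n r≤n)))))) ⟩
      q ^ r - q ^ suc n ∎

    G : ℕ → ℕ → Carrier
    G r s = 1# - z * w * q * (q ^ r * q ^ s)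

    Pᵣ : ℕ → Carrier
    Pᵣ r = (1# - q * q ^ r) * (1# - z * q * q ^ r) * (1# - z * w * q * q ^ r)

    Pₛ : ℕ → Carrier
    Pₛ s = (1# - q * q ^ s) * (1# - w * q * q ^ s) * (1# - z * w * q * q ^ s)

    den-sucᵣ : ∀ n m r s → r ≤ n → den (suc n) m r s * Pᵣ r ≈ den (suc n) m (suc r) s * κ n r
    den-sucᵣ n m r s r≤n = begin
      poch q q (suc n ∸ r) * poch q q (m ∸ s) * (ρ * σ) * Pᵣ r
        ≈⟨ *-congʳ (*-congʳ (*-congʳ (poch-q-suc-∸ n r r≤n))) ⟩
      poch q q (n ∸ r) * κ n r * poch q q (m ∸ s) * (ρ * σ) * Pᵣ r
        ≈⟨ solve 10 (λ p k p′ a b c σ a′ b′ c′ →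
             p :* k :* p′ :* (a :* b :* c :* σ) :* (a′ :* b′ :* c′) := p :* p′ :* (a :* a′ :* (b :* b′) :* (c :* c′) :* σ) :* k)
             refl (poch q q (n ∸ r)) (κ n r) (poch q q (m ∸ s)) (poch q q r) (poch (z * q) q r) (poch (z * w * q) q r) σ
             (1# - q * q ^ r) (1# - z * q * q ^ r) (1# - z * w * q * q ^ r) ⟩
      den (suc n) m (suc r) s * κ n r ∎
      where
      ρ : Carrier
      ρ = poch q q r * poch (z * q) q r * poch (z * w * q) q r
      σ : Carrier
      σ = poch q q s * poch (w * q) q s * poch (z * w * q) q s

    den-sucₛ : ∀ n m r s → s ≤ m → den n (suc m) r s * Pₛ s ≈ den n (suc m) r (suc s) * κ m s
    den-sucₛ n m r s s≤m = begin
      poch q q (n ∸ r) * poch q q (suc m ∸ s) * (ρ * σ) * Pₛ s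
        ≈⟨ *-congʳ (*-congʳ (*-congˡ (poch-q-suc-∸ m s s≤m))) ⟩
      poch q q (n ∸ r) * (poch q q (m ∸ s) * κ m s) * (ρ * σ) * Pₛ s
        ≈⟨ solve 10 (λ p p′ k ρ a b c a′ b′ c′ →
             p :* (p′ :* k) :* (ρ :* (a :* b :* c)) :* (a′ :* b′ :* c′) := p :* p′ :* (ρ :* (a :* a′ :* (b :* b′) :* (c :* c′))) :* k)
             refl (poch q q (n ∸ r)) (poch q q (m ∸ s)) (κ m s) ρ (poch q q s) (poch (w * q) q s) (poch (z * w * q) q s)
             (1# - q * q ^ s) (1# - w * q * q ^ s) (1# - z * w * q * q ^ s) ⟩
      den n (suc m) r (suc s) * κ m s ∎
      where
      ρ : Carrier
      ρ = poch q q r * poch (z * q) q r * poch (z * w * q) q r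
      σ : Carrier
      σ = poch q q s * poch (w * q) q s * poch (z * w * q) q s

    num-sucᵣ : ∀ r s → num (suc r) s * q ^ s ≈ num r s * (z * q * q ^ r * q ^ r * G r s)
    num-sucᵣ r s = begin
      z * z ^ r * w ^ s * q ^ quadratic (suc r) s * (Φnum z w q r s * (1# - z * w * q * q ^ (r ℕ.+ s))) * q ^ s
        ≈⟨ solve 9 (λ z zʳ wˢ e φ w q Q y → z :* zʳ :* wˢ :* e :* (φ :* (𝟙 :- z :* w :* q :* Q)) :* y := z :* zʳ :* wˢ :* φ :* (e :* y) :* (𝟙 :- z :* w :* q :* Q))
             refl z (z ^ r) (w ^ s) (q ^ quadratic (suc r) s) (Φnum z w q r s) w q (q ^ (r ℕ.+ s)) (q ^ s) ⟩
      z * z ^ r * w ^ s * Φnum z w q r s * (q ^ quadratic (suc r) s * q ^ s) * (1# - z * w * q * q ^ (r ℕ.+ s))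
        ≈⟨ *-cong (*-congˡ (q^quadratic-sucˡ q r s)) (+-congˡ (-‿cong (*-congˡ (^-+ q r s)))) ⟩
      z * z ^ r * w ^ s * Φnum z w q r s * (q ^ quadratic r s * (q * (q ^ r * q ^ r))) * G r s
        ≈⟨ solve 9 (λ z zʳ wˢ e φ q x g w → z :* zʳ :* wˢ :* φ :* (e :* (q :* (x :* x))) :* g := zʳ :* wˢ :* e :* φ :* (z :* q :* x :* x :* g))
             refl z (z ^ r) (w ^ s) (q ^ quadratic r s) (Φnum z w q r s) q (q ^ r) (G r s) w ⟩
      num r s * (z * q * q ^ r * q ^ r * G r s) ∎

    num-sucₛ : ∀ r s → num r (suc s) * q ^ r ≈ num r s * (w * q * q ^ s * q ^ s * G r s)
    num-sucₛ r s = begin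
      z ^ r * (w * w ^ s) * q ^ quadratic r (suc s) * poch (z * w * q) q (r ℕ.+ suc s) * q ^ r
        ≡⟨ ≡.cong (λ k → z ^ r * (w * w ^ s) * q ^ quadratic r (suc s) * poch (z * w * q) q k * q ^ r) (ℕ.+-suc r s) ⟩
      z ^ r * (w * w ^ s) * q ^ quadratic r (suc s) * (Φnum z w q r s * (1# - z * w * q * q ^ (r ℕ.+ s))) * q ^ r
        ≈⟨ solve 9 (λ zʳ w wˢ e φ z q Q x → zʳ :* (w :* wˢ) :* e :* (φ :* (𝟙 :- z :* w :* q :* Q)) :* x := w :* zʳ :* wˢ :* φ :* (e :* x) :* (𝟙 :- z :* w :* q :* Q))
             refl (z ^ r) w (w ^ s) (q ^ quadratic r (suc s)) (Φnum z w q r s) z q (q ^ (r ℕ.+ s)) (q ^ r) ⟩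
      w * z ^ r * w ^ s * Φnum z w q r s * (q ^ quadratic r (suc s) * q ^ r) * (1# - z * w * q * q ^ (r ℕ.+ s))
        ≈⟨ *-cong (*-congˡ (q^quadratic-sucʳ q r s)) (+-congˡ (-‿cong (*-congˡ (^-+ q r s)))) ⟩
      w * z ^ r * w ^ s * Φnum z w q r s * (q ^ quadratic r s * (q * (q ^ s * q ^ s))) * G r s
        ≈⟨ solve 9 (λ w zʳ wˢ e φ q y g z → w :* zʳ :* wˢ :* φ :* (e :* (q :* (y :* y))) :* g := zʳ :* wˢ :* e :* φ :* (w :* q :* y :* y :* g))
             refl w (z ^ r) (w ^ s) (q ^ quadratic r s) (Φnum z w q r s) q (q ^ s) (G r s) z ⟩
      num r s * (w * q * q ^ s * q ^ s * G r s) ∎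

    𝒦Φ-sucᵣ : ∀ n m r s → r ≤ n →
      𝒦Φ (suc n) m (suc r) s * (Pᵣ r * q ^ s) ≈ 𝒦Φ (suc n) m r s * (z * q * q ^ r * (q ^ r - q ^ suc n) * G r s)
    𝒦Φ-sucᵣ n m r s r≤n =
      cross-multiply (den-nonZero (suc n) m (suc r) s) (den-nonZero (suc n) m r s)
        (𝒦Φ-*-den (suc n) m (suc r) s) (𝒦Φ-*-den (suc n) m r s) (begin
          num (suc r) s * (Pᵣ r * q ^ s) * den (suc n) m r s
            ≈⟨ solve 4 (λ ν p y d → ν :* (p :* y) :* d := ν :* y :* (d :* p)) refl (num (suc r) s) (Pᵣ r) (q ^ s) (den (suc n) m r s) ⟩
          num (suc r) s * q ^ s * (den (suc n) m r s * Pᵣ r)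
            ≈⟨ *-cong (num-sucᵣ r s) (den-sucᵣ n m r s r≤n) ⟩
          num r s * (z * q * q ^ r * q ^ r * G r s) * (den (suc n) m (suc r) s * κ n r)
            ≈⟨ solve 7 (λ ν z q x g d k → ν :* (z :* q :* x :* x :* g) :* (d :* k) := ν :* (z :* q :* x :* g) :* (x :* k) :* d)
                 refl (num r s) z q (q ^ r) (G r s) (den (suc n) m (suc r) s) (κ n r) ⟩
          num r s * (z * q * q ^ r * G r s) * (q ^ r * κ n r) * den (suc n) m (suc r) s
            ≈⟨ *-congʳ (*-congˡ (qʳ-*-κ n r r≤n)) ⟩
          num r s * (z * q * q ^ r * G r s) * (q ^ r - q ^ suc n) * den (suc n) m (suc r) s
            ≈⟨ *-congʳ (solve 6 (λ ν z q x g d → ν :* (z :* q :* x :* g) :* d := ν :* (z :* q :* x :* d :* g)) refl (num r s) z q (q ^ r) (G r s) (q ^ r - q ^ suc n)) ⟩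
          num r s * (z * q * q ^ r * (q ^ r - q ^ suc n) * G r s) * den (suc n) m (suc r) s ∎)

    𝒦Φ-sucₛ : ∀ n m r s → s ≤ m →
      𝒦Φ n (suc m) r (suc s) * (Pₛ s * q ^ r) ≈ 𝒦Φ n (suc m) r s * (w * q * q ^ s * (q ^ s - q ^ suc m) * G r s)
    𝒦Φ-sucₛ n m r s s≤m =
      cross-multiply (den-nonZero n (suc m) r (suc s)) (den-nonZero n (suc m) r s)
        (𝒦Φ-*-den n (suc m) r (suc s)) (𝒦Φ-*-den n (suc m) r s) (begin
          num r (suc s) * (Pₛ s * q ^ r) * den n (suc m) r s
            ≈⟨ solve 4 (λ ν p x d → ν :* (p :* x) :* d := ν :* x :* (d :* p)) refl (num r (suc s)) (Pₛ s) (q ^ r) (den n (suc m) r s) ⟩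
          num r (suc s) * q ^ r * (den n (suc m) r s * Pₛ s)
            ≈⟨ *-cong (num-sucₛ r s) (den-sucₛ n m r s s≤m) ⟩
          num r s * (w * q * q ^ s * q ^ s * G r s) * (den n (suc m) r (suc s) * κ m s)
            ≈⟨ solve 7 (λ ν w q y g d k → ν :* (w :* q :* y :* y :* g) :* (d :* k) := ν :* (w :* q :* y :* g) :* (y :* k) :* d)
                 refl (num r s) w q (q ^ s) (G r s) (den n (suc m) r (suc s)) (κ m s) ⟩
          num r s * (w * q * q ^ s * G r s) * (q ^ s * κ m s) * den n (suc m) r (suc s)
            ≈⟨ *-congʳ (*-congˡ (qʳ-*-κ m s s≤m)) ⟩
          num r s * (w * q * q ^ s * G r s) * (q ^ s - q ^ suc m) * den n (suc m) r (suc s)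
            ≈⟨ *-congʳ (solve 6 (λ ν w q y g d → ν :* (w :* q :* y :* g) :* d := ν :* (w :* q :* y :* d :* g)) refl (num r s) w q (q ^ s) (G r s) (q ^ s - q ^ suc m)) ⟩
          num r s * (w * q * q ^ s * (q ^ s - q ^ suc m) * G r s) * den n (suc m) r (suc s) ∎)

    𝒦Φ-sucₙ : ∀ n m r s → r ≤ n → 𝒦Φ n m r s * q ^ r ≈ 𝒦Φ (suc n) m r s * (q ^ r - q ^ suc n)
    𝒦Φ-sucₙ n m r s r≤n =
      cross-multiply (den-nonZero n m r s) (den-nonZero (suc n) m r s)
        (𝒦Φ-*-den n m r s) (𝒦Φ-*-den (suc n) m r s) (begin
          num r s * q ^ r * den (suc n) m r s
            ≈⟨ *-congˡ (*-congʳ (*-congʳ (poch-q-suc-∸ n r r≤n))) ⟩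
          num r s * q ^ r * (poch q q (n ∸ r) * κ n r * poch q q (m ∸ s) * Φden z w q r s)
            ≈⟨ solve 6 (λ ν x p k p′ φ → ν :* x :* (p :* k :* p′ :* φ) := ν :* (x :* k) :* (p :* p′ :* φ))
                 refl (num r s) (q ^ r) (poch q q (n ∸ r)) (κ n r) (poch q q (m ∸ s)) (Φden z w q r s) ⟩
          num r s * (q ^ r * κ n r) * den n m r s
            ≈⟨ *-congʳ (*-congˡ (qʳ-*-κ n r r≤n)) ⟩
          num r s * (q ^ r - q ^ suc n) * den n m r s ∎)

    Q : ℕ → ℕ → Carrier
    Q n m = 1# - z * w * q * q ^ (n ℕ.+ m)

    Φ-sucₙ : ∀ n m → Φ z w q (suc n) m * Pᵣ n ≈ Φ z w q n m * Q n m
    Φ-sucₙ n m =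
      cross-multiply (Φden-nonZero (suc n) m) (Φden-nonZero n m)
        (Φ-*-Φden z w q (suc n) m (Φden-nonZero (suc n) m)) (Φ-*-Φden z w q n m (Φden-nonZero n m))
        (solve 9 (λ φ g a b c a′ b′ c′ σ → φ :* g :* (a′ :* b′ :* c′) :* (a :* b :* c :* σ) := φ :* g :* (a :* a′ :* (b :* b′) :* (c :* c′) :* σ))
           refl (Φnum z w q n m) (Q n m) (poch q q n) (poch (z * q) q n) (poch (z * w * q) q n)
           (1# - q * q ^ n) (1# - z * q * q ^ n) (1# - z * w * q * q ^ n) (poch q q m * poch (w * q) q m * poch (z * w * q) q m))

    G₀ : ℕ → ℕ → Carrier
    G₀ r s = 1# - z * w * (q ^ r * q ^ s)

    G₀-sucᵣ≉0 : ∀ r s → NonZero (G₀ (suc r) s)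
    G₀-sucᵣ≉0 r s = ≈-nonZero (+-congˡ (-‿cong zwq^≈)) (1-zwqqʲ≉0 (r ℕ.+ s))
      where
      zwq^≈ : z * w * q * q ^ (r ℕ.+ s) ≈ z * w * (q * q ^ r * q ^ s)
      zwq^≈ = trans (*-congˡ (^-+ q r s))
        (solve 5 (λ z w q x y → z :* w :* q :* (x :* y) := z :* w :* (q :* x :* y)) refl z w q (q ^ r) (q ^ s))

    G₀-sucₛ≉0 : ∀ r s → NonZero (G₀ r (suc s))
    G₀-sucₛ≉0 r s = ≈-nonZero (+-congˡ (-‿cong zwq^≈)) (1-zwqqʲ≉0 (r ℕ.+ s))
      where
      zwq^≈ : z * w * q * q ^ (r ℕ.+ s) ≈ z * w * (q ^ r * (q * q ^ s))
      zwq^≈ = trans (*-congˡ (^-+ q r s))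
        (solve 5 (λ z w q x y → z :* w :* q :* (x :* y) := z :* w :* (x :* (q :* y))) refl z w q (q ^ r) (q ^ s))

    -- The certificate of the recurrence in n: A − B telescopes in r and C − D in s.
    -- At r = s = 0 the inverse in B and D may be 1/0, but B and D carry the vanishing factors 1 − q^r and 1 − q^s.
    A B C D : ℕ → ℕ → ℕ → ℕ → Carrier
    A n m r s = 𝒦Φ n m r s * (z * q ^ n * (q ^ r - q ^ n) * (z * w * q ^ n * q ^ s - 1#)) * (q ^ s) ⁻¹
    B n m r s = 𝒦Φ n m r s * ((1# - q ^ r) * (1# - z * q ^ r) * (1# - z * w * q ^ r) * q ^ n * (z * w * q ^ n * q ^ s - 1#)) * (q ^ r * G₀ r s) ⁻¹
    C n m r s = 𝒦Φ n m r s * (z * w * q ^ n * (q ^ s - q ^ m) * (q ^ n - q ^ r)) * (q ^ r) ⁻¹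
    D n m r s = 𝒦Φ n m r s * (z * q ^ n * (1# - q ^ s) * (1# - w * q ^ s) * (1# - z * w * q ^ s) * (q ^ n - q ^ r)) * (q ^ s * G₀ r s) ⁻¹

    A-at-n : ∀ n m s → A n m n s ≈ 0#
    A-at-n n m s = solve 6 (λ t z N w y i → t :* (z :* N :* (N :- N) :* (z :* w :* N :* y :- 𝟙)) :* i := 𝟘)
      refl (𝒦Φ n m n s) z (q ^ n) w (q ^ s) ((q ^ s) ⁻¹)

    B-at-0 : ∀ n m s → B n m 0 s ≈ 0#
    B-at-0 n m s = solve 6 (λ t z N w y i → t :* ((𝟙 :- 𝟙) :* (𝟙 :- z :* 𝟙) :* (𝟙 :- z :* w :* 𝟙) :* N :* (z :* w :* N :* y :- 𝟙)) :* i := 𝟘)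
      refl (𝒦Φ n m 0 s) z (q ^ n) w (q ^ s) ((1# * G₀ 0 s) ⁻¹)

    C-at-m : ∀ n m r → C n m r m ≈ 0#
    C-at-m n m r = solve 7 (λ t z w N M x i → t :* (z :* w :* N :* (M :- M) :* (N :- x)) :* i := 𝟘)
      refl (𝒦Φ n m r m) z w (q ^ n) (q ^ m) (q ^ r) ((q ^ r) ⁻¹)

    D-at-0 : ∀ n m r → D n m r 0 ≈ 0#
    D-at-0 n m r = solve 6 (λ t z w N x i → t :* (z :* N :* (𝟙 :- 𝟙) :* (𝟙 :- w :* 𝟙) :* (𝟙 :- z :* w :* 𝟙) :* (N :- x)) :* i := 𝟘)
      refl (𝒦Φ n m r 0) z w (q ^ n) (q ^ r) ((1# * G₀ r 0) ⁻¹)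

    A≈B-sucᵣ : ∀ n m r s → r < n → A n m r s ≈ B n m (suc r) s
    A≈B-sucᵣ (suc n) m r s (s≤s r≤n) = *-cancelʳ (*-nonZero (qʳ≉0 s) qxG≉0) (begin
      T₀ * a * (q ^ s) ⁻¹ * (q ^ s * (q * q ^ r * G′))
        ≈⟨ ≈-*-unit (⁻¹-inverseʳ (qʳ≉0 s)) (solve 6 (λ t a i y x g → t :* a :* i :* (y :* (x :* g)) := t :* a :* (x :* g) :* (y :* i))
             refl T₀ a ((q ^ s) ⁻¹) (q ^ s) (q * q ^ r) G′) ⟩
      T₀ * a * (q * q ^ r * G′)
        ≈⟨ solve 7 (λ t z N x w y q → t :* (z :* N :* (x :- N) :* (z :* w :* N :* y :- 𝟙)) :* (q :* x :* (𝟙 :- z :* w :* (q :* x :* y)))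
                                     := t :* (z :* q :* x :* (x :- N) :* (𝟙 :- z :* w :* q :* (x :* y))) :* (N :* (z :* w :* N :* y :- 𝟙)))
             refl T₀ z N (q ^ r) w (q ^ s) q ⟩
      T₀ * (z * q * q ^ r * (q ^ r - N) * G r s) * (N * (z * w * N * q ^ s - 1#))
        ≈⟨ *-congʳ (𝒦Φ-sucᵣ n m r s r≤n) ⟨
      T₁ * (Pᵣ r * q ^ s) * (N * (z * w * N * q ^ s - 1#))
        ≈⟨ solve 7 (λ t z N x w y q → t :* ((𝟙 :- q :* x) :* (𝟙 :- z :* q :* x) :* (𝟙 :- z :* w :* q :* x) :* y) :* (N :* (z :* w :* N :* y :- 𝟙))
                                     := t :* ((𝟙 :- q :* x) :* (𝟙 :- z :* (q :* x)) :* (𝟙 :- z :* w :* (q :* x)) :* N :* (z :* w :* N :* y :- 𝟙)) :* y)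
             refl T₁ z N (q ^ r) w (q ^ s) q ⟩
      T₁ * b * q ^ s
        ≈⟨ ≈-*-unit (⁻¹-inverseˡ qxG≉0) (solve 5 (λ t b i y k → t :* b :* i :* (y :* k) := t :* b :* y :* (i :* k))
             refl T₁ b ((q * q ^ r * G′) ⁻¹) (q ^ s) (q * q ^ r * G′)) ⟨
      T₁ * b * (q * q ^ r * G′) ⁻¹ * (q ^ s * (q * q ^ r * G′)) ∎)
      where
      N : Carrier
      N = q ^ suc n
      T₀ : Carrier
      T₀ = 𝒦Φ (suc n) m r s
      T₁ : Carrier
      T₁ = 𝒦Φ (suc n) m (suc r) s
      G′ : Carrier
      G′ = G₀ (suc r) s
      a : Carrier
      a = z * N * (q ^ r - N) * (z * w * N * q ^ s - 1#)
      b : Carrier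
      b = (1# - q * q ^ r) * (1# - z * (q * q ^ r)) * (1# - z * w * (q * q ^ r)) * N * (z * w * N * q ^ s - 1#)
      qxG≉0 : NonZero (q * q ^ r * G′)
      qxG≉0 = *-nonZero (*-nonZero q≉0 (qʳ≉0 r)) (G₀-sucᵣ≉0 r s)

    C≈D-sucₛ : ∀ n m r s → s < m → C n m r s ≈ D n m r (suc s)
    C≈D-sucₛ n (suc m) r s (s≤s s≤m) = *-cancelʳ (*-nonZero (qʳ≉0 r) qyG≉0) (begin
      T₀ * c′ * (q ^ r) ⁻¹ * (q ^ r * (q * q ^ s * G′))
        ≈⟨ ≈-*-unit (⁻¹-inverseʳ (qʳ≉0 r)) (solve 6 (λ t a i x y g → t :* a :* i :* (x :* (y :* g)) := t :* a :* (y :* g) :* (x :* i))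
             refl T₀ c′ ((q ^ r) ⁻¹) (q ^ r) (q * q ^ s) G′) ⟩
      T₀ * c′ * (q * q ^ s * G′)
        ≈⟨ solve 8 (λ t z N x w y q M → t :* (z :* w :* N :* (y :- M) :* (N :- x)) :* (q :* y :* (𝟙 :- z :* w :* (x :* (q :* y))))
                                       := t :* (w :* q :* y :* (y :- M) :* (𝟙 :- z :* w :* q :* (x :* y))) :* (z :* N :* (N :- x)))
             refl T₀ z N (q ^ r) w (q ^ s) q M ⟩
      T₀ * (w * q * q ^ s * (q ^ s - M) * G r s) * (z * N * (N - q ^ r))
        ≈⟨ *-congʳ (𝒦Φ-sucₛ n m r s s≤m) ⟨
      T₁ * (Pₛ s * q ^ r) * (z * N * (N - q ^ r))
        ≈⟨ solve 7 (λ t z N x w y q → t :* ((𝟙 :- q :* y) :* (𝟙 :- w :* q :* y) :* (𝟙 :- z :* w :* q :* y) :* x) :* (z :* N :* (N :- x))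
                                     := t :* (z :* N :* (𝟙 :- q :* y) :* (𝟙 :- w :* (q :* y)) :* (𝟙 :- z :* w :* (q :* y)) :* (N :- x)) :* x)
             refl T₁ z N (q ^ r) w (q ^ s) q ⟩
      T₁ * d * q ^ r
        ≈⟨ ≈-*-unit (⁻¹-inverseˡ qyG≉0) (solve 5 (λ t b i y k → t :* b :* i :* (y :* k) := t :* b :* y :* (i :* k))
             refl T₁ d ((q * q ^ s * G′) ⁻¹) (q ^ r) (q * q ^ s * G′)) ⟨
      T₁ * d * (q * q ^ s * G′) ⁻¹ * (q ^ r * (q * q ^ s * G′)) ∎)
      where
      N : Carrier
      N = q ^ n
      M : Carrier
      M = q ^ suc m
      T₀ : Carrier
      T₀ = 𝒦Φ n (suc m) r s
      T₁ : Carrier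
      T₁ = 𝒦Φ n (suc m) r (suc s)
      G′ : Carrier
      G′ = G₀ r (suc s)
      c′ : Carrier
      c′ = z * w * N * (q ^ s - M) * (N - q ^ r)
      d : Carrier
      d = z * N * (1# - q * q ^ s) * (1# - w * (q * q ^ s)) * (1# - z * w * (q * q ^ s)) * (N - q ^ r)
      qyG≉0 : NonZero (q * q ^ s * G′)
      qyG≉0 = *-nonZero (*-nonZero q≉0 (qʳ≉0 s)) (G₀-sucₛ≉0 r s)

    Q′ : ℕ → ℕ → Carrier
    Q′ n m = 1# - z * w * q ^ n * q ^ m

    Q≈Q′ : ∀ n m → Q n m ≈ Q′ (suc n) m
    Q≈Q′ n m = +-congˡ (-‿cong (trans (*-congˡ (^-+ q n m))
      (solve 5 (λ z w q x y → z :* w :* q :* (x :* y) := z :* w :* (q :* x) :* y) refl z w q (q ^ n) (q ^ m))))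

    certificate-generic : ∀ n m r s → NonZero (G₀ r s) →
      𝒦Φ (suc n) m r s * (Pᵣ n - Q′ (suc n) m * ((q ^ r - q ^ suc n) * (q ^ r) ⁻¹))
        ≈ (A (suc n) m r s - B (suc n) m r s) + (C (suc n) m r s - D (suc n) m r s)
    certificate-generic n m r s g≉0 = *-cancelʳ xyg≉0 (begin
      t * (Pᵣ n - Q′ (suc n) m * ((x - N) * x ⁻¹)) * (x * y * g)
        ≈⟨ solve 9 (λ t z w q xₙ M x y x⁻¹ →
             t :* ((𝟙 :- q :* xₙ) :* (𝟙 :- z :* q :* xₙ) :* (𝟙 :- z :* w :* q :* xₙ) :- (𝟙 :- z :* w :* (q :* xₙ) :* M) :* ((x :- q :* xₙ) :* x⁻¹))
               :* (x :* y :* (𝟙 :- z :* w :* (x :* y)))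
             := t :* ((𝟙 :- q :* xₙ) :* (𝟙 :- z :* q :* xₙ) :* (𝟙 :- z :* w :* q :* xₙ)) :* x :* y :* (𝟙 :- z :* w :* (x :* y))
                :- t :* (𝟙 :- z :* w :* (q :* xₙ) :* M) :* (x :- q :* xₙ) :* y :* (𝟙 :- z :* w :* (x :* y)) :* (x :* x⁻¹))
             refl t z w q (q ^ n) M x y (x ⁻¹) ⟩
      l₁ - l₂ * (x * x ⁻¹)
        ≈⟨ +-congˡ (-‿cong (*-congˡ (⁻¹-inverseʳ (qʳ≉0 r)))) ⟩
      l₁ - l₂ * 1#
        ≈⟨ solve 8 (λ t z w q xₙ M x y →
             t :* ((𝟙 :- q :* xₙ) :* (𝟙 :- z :* q :* xₙ) :* (𝟙 :- z :* w :* q :* xₙ)) :* x :* y :* (𝟙 :- z :* w :* (x :* y))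
               :- t :* (𝟙 :- z :* w :* (q :* xₙ) :* M) :* (x :- q :* xₙ) :* y :* (𝟙 :- z :* w :* (x :* y)) :* 𝟙
             := (t :* (z :* (q :* xₙ) :* (x :- q :* xₙ) :* (z :* w :* (q :* xₙ) :* y :- 𝟙)) :* x :* (𝟙 :- z :* w :* (x :* y)) :* 𝟙
                 :- t :* ((𝟙 :- x) :* (𝟙 :- z :* x) :* (𝟙 :- z :* w :* x) :* (q :* xₙ) :* (z :* w :* (q :* xₙ) :* y :- 𝟙)) :* y :* 𝟙)
               :+ (t :* (z :* w :* (q :* xₙ) :* (y :- M) :* (q :* xₙ :- x)) :* y :* (𝟙 :- z :* w :* (x :* y)) :* 𝟙
                 :- t :* (z :* (q :* xₙ) :* (𝟙 :- y) :* (𝟙 :- w :* y) :* (𝟙 :- z :* w :* y) :* (q :* xₙ :- x)) :* x :* 𝟙))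
             refl t z w q (q ^ n) M x y ⟩
      (t * a * x * g * 1# - t * b * y * 1#) + (t * c′ * y * g * 1# - t * d * x * 1#)
        ≈⟨ +-cong (+-cong (*-congˡ (sym (⁻¹-inverseʳ (qʳ≉0 s)))) (-‿cong (*-congˡ (sym (⁻¹-inverseʳ xg≉0)))))
                  (+-cong (*-congˡ (sym (⁻¹-inverseʳ (qʳ≉0 r)))) (-‿cong (*-congˡ (sym (⁻¹-inverseʳ yg≉0))))) ⟩
      (t * a * x * g * (y * y ⁻¹) - t * b * y * (x * g * (x * g) ⁻¹)) + (t * c′ * y * g * (x * x ⁻¹) - t * d * x * (y * g * (y * g) ⁻¹))
        ≈⟨ solve 12 (λ t a b c d x y g x⁻¹ y⁻¹ xg⁻¹ yg⁻¹ →
             (t :* a :* x :* g :* (y :* y⁻¹) :- t :* b :* y :* (x :* g :* xg⁻¹)) :+ (t :* c :* y :* g :* (x :* x⁻¹) :- t :* d :* x :* (y :* g :* yg⁻¹))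
             := (t :* a :* y⁻¹ :- t :* b :* xg⁻¹ :+ (t :* c :* x⁻¹ :- t :* d :* yg⁻¹)) :* (x :* y :* g))
             refl t a b c′ d x y g (x ⁻¹) (y ⁻¹) ((x * g) ⁻¹) ((y * g) ⁻¹) ⟩
      ((A (suc n) m r s - B (suc n) m r s) + (C (suc n) m r s - D (suc n) m r s)) * (x * y * g) ∎)
      where
      N : Carrier
      N = q ^ suc n
      M : Carrier
      M = q ^ m
      t : Carrier
      t = 𝒦Φ (suc n) m r s
      x : Carrier
      x = q ^ r
      y : Carrier
      y = q ^ s
      g : Carrier
      g = G₀ r s
      l₁ : Carrier
      l₁ = t * Pᵣ n * x * y * g
      l₂ : Carrier
      l₂ = t * Q′ (suc n) m * (x - N) * y * g
      a : Carrier
      a = z * N * (x - N) * (z * w * N * y - 1#)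
      b : Carrier
      b = (1# - x) * (1# - z * x) * (1# - z * w * x) * N * (z * w * N * y - 1#)
      c′ : Carrier
      c′ = z * w * N * (y - M) * (N - x)
      d : Carrier
      d = z * N * (1# - y) * (1# - w * y) * (1# - z * w * y) * (N - x)
      xg≉0 : NonZero (x * g)
      xg≉0 = *-nonZero (qʳ≉0 r) g≉0
      yg≉0 : NonZero (y * g)
      yg≉0 = *-nonZero (qʳ≉0 s) g≉0
      xyg≉0 : NonZero (x * y * g)
      xyg≉0 = *-nonZero (*-nonZero (qʳ≉0 r) (qʳ≉0 s)) g≉0

    certificate-origin : ∀ n m →
      𝒦Φ (suc n) m 0 0 * (Pᵣ n - Q′ (suc n) m * ((q ^ 0 - q ^ suc n) * (q ^ 0) ⁻¹))
        ≈ (A (suc n) m 0 0 - B (suc n) m 0 0) + (C (suc n) m 0 0 - D (suc n) m 0 0)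
    certificate-origin n m = begin
      t * (Pᵣ n - Q′ (suc n) m * ((1# - N) * 1# ⁻¹))
        ≈⟨ *-congˡ (+-congˡ (-‿cong (*-congˡ (*-congˡ 1⁻¹≈1)))) ⟩
      t * (Pᵣ n - Q′ (suc n) m * ((1# - N) * 1#))
        ≈⟨ solve 8 (λ t z w q xₙ M i j →
             t :* ((𝟙 :- q :* xₙ) :* (𝟙 :- z :* q :* xₙ) :* (𝟙 :- z :* w :* q :* xₙ) :- (𝟙 :- z :* w :* (q :* xₙ) :* M) :* ((𝟙 :- q :* xₙ) :* 𝟙))
             := (t :* (z :* (q :* xₙ) :* (𝟙 :- q :* xₙ) :* (z :* w :* (q :* xₙ) :* 𝟙 :- 𝟙)) :* 𝟙
                  :- t :* ((𝟙 :- 𝟙) :* (𝟙 :- z :* 𝟙) :* (𝟙 :- z :* w :* 𝟙) :* (q :* xₙ) :* (z :* w :* (q :* xₙ) :* 𝟙 :- 𝟙)) :* i)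
                :+ (t :* (z :* w :* (q :* xₙ) :* (𝟙 :- M) :* (q :* xₙ :- 𝟙)) :* 𝟙
                  :- t :* (z :* (q :* xₙ) :* (𝟙 :- 𝟙) :* (𝟙 :- w :* 𝟙) :* (𝟙 :- z :* w :* 𝟙) :* (q :* xₙ :- 𝟙)) :* j))
             refl t z w q (q ^ n) (q ^ m) ((1# * G₀ 0 0) ⁻¹) ((1# * G₀ 0 0) ⁻¹) ⟩
      (t * a * 1# - B (suc n) m 0 0) + (t * c′ * 1# - D (suc n) m 0 0)
        ≈⟨ +-cong (+-congʳ (*-congˡ (sym 1⁻¹≈1))) (+-congʳ (*-congˡ (sym 1⁻¹≈1))) ⟩
      (A (suc n) m 0 0 - B (suc n) m 0 0) + (C (suc n) m 0 0 - D (suc n) m 0 0) ∎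
      where
      N : Carrier
      N = q ^ suc n
      t : Carrier
      t = 𝒦Φ (suc n) m 0 0
      a : Carrier
      a = z * N * (1# - N) * (z * w * N * 1# - 1#)
      c′ : Carrier
      c′ = z * w * N * (1# - q ^ m) * (N - 1#)
      1⁻¹≈1 : 1# ⁻¹ ≈ 1#
      1⁻¹≈1 = ⁻¹-≈1 refl

    certificate : ∀ n m r s →
      𝒦Φ (suc n) m r s * (Pᵣ n - Q′ (suc n) m * ((q ^ r - q ^ suc n) * (q ^ r) ⁻¹))
        ≈ (A (suc n) m r s - B (suc n) m r s) + (C (suc n) m r s - D (suc n) m r s)
    certificate n m zero    zero    = certificate-origin n m
    certificate n m (suc r) s       = certificate-generic n m (suc r) s (G₀-sucᵣ≉0 r s)
    certificate n m zero    (suc s) = certificate-generic n m zero (suc s) (G₀-sucₛ≉0 zero s)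

    Σ𝒦Φ : ℕ → ℕ → Carrier
    Σ𝒦Φ n m = sumTo n (λ r → sumTo m (𝒦Φ n m r))

    Σ𝒦Φ-as-sucₙ : ∀ n m →
      Σ𝒦Φ n m ≈ sumTo (suc n) (λ r → sumTo m (λ s → 𝒦Φ (suc n) m r s * ((q ^ r - q ^ suc n) * (q ^ r) ⁻¹)))
    Σ𝒦Φ-as-sucₙ n m = begin
      Σ𝒦Φ n m               ≈⟨ sum-cong n (λ r r≤n → sum-cong m (λ s _ → 𝒦Φ≈ r s r≤n)) ⟩
      sumTo n f             ≈⟨ +-identityʳ _ ⟨
      sumTo n f + 0#        ≈⟨ +-congˡ (sum-zero m (λ s _ → vanishes s)) ⟨
      sumTo (suc n) f       ∎
      where
      f : ℕ → Carrier
      f r = sumTo m (λ s → 𝒦Φ (suc n) m r s * ((q ^ r - q ^ suc n) * (q ^ r) ⁻¹))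
      vanishes : ∀ s → 𝒦Φ (suc n) m (suc n) s * ((q ^ suc n - q ^ suc n) * (q ^ suc n) ⁻¹) ≈ 0#
      vanishes s = solve 3 (λ t N i → t :* ((N :- N) :* i) := 𝟘) refl (𝒦Φ (suc n) m (suc n) s) (q ^ suc n) ((q ^ suc n) ⁻¹)
      𝒦Φ≈ : ∀ r s → r ≤ n → 𝒦Φ n m r s ≈ 𝒦Φ (suc n) m r s * ((q ^ r - q ^ suc n) * (q ^ r) ⁻¹)
      𝒦Φ≈ r s r≤n = *-cancelʳ (qʳ≉0 r) (trans (𝒦Φ-sucₙ n m r s r≤n)
        (sym (≈-*-unit (⁻¹-inverseˡ (qʳ≉0 r)) (solve 4 (λ t d i x → t :* (d :* i) :* x := t :* d :* (i :* x))
           refl (𝒦Φ (suc n) m r s) (q ^ r - q ^ suc n) ((q ^ r) ⁻¹) (q ^ r)))))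

    ΣA-B≈0 : ∀ n m → sumTo (suc n) (λ r → sumTo m (λ s → A (suc n) m r s - B (suc n) m r s)) ≈ 0#
    ΣA-B≈0 n m = begin
      sumTo (suc n) (λ r → sumTo m (λ s → A (suc n) m r s - B (suc n) m r s))
        ≈⟨ sum-comm (suc n) m _ ⟩
      sumTo m (λ s → sumTo (suc n) (λ r → A (suc n) m r s - B (suc n) m r s))
        ≈⟨ sum-zero m (λ s _ → begin
             sumTo (suc n) (λ r → A (suc n) m r s - B (suc n) m r s)
               ≈⟨ sum-telescope (suc n) _ _ (λ r r<1+n → A≈B-sucᵣ (suc n) m r s r<1+n) ⟩
             A (suc n) m (suc n) s - B (suc n) m 0 s
               ≈⟨ +-cong (A-at-n (suc n) m s) (-‿cong (B-at-0 (suc n) m s)) ⟩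
             0# - 0#
               ≈⟨ -‿inverseʳ 0# ⟩
             0# ∎) ⟩
      0# ∎

    ΣC-D≈0 : ∀ n m → sumTo n (λ r → sumTo m (λ s → C n m r s - D n m r s)) ≈ 0#
    ΣC-D≈0 n m = sum-zero n (λ r _ → begin
      sumTo m (λ s → C n m r s - D n m r s)   ≈⟨ sum-telescope m _ _ (C≈D-sucₛ n m r) ⟩
      C n m r m - D n m r 0                   ≈⟨ +-cong (C-at-m n m r) (-‿cong (D-at-0 n m r)) ⟩
      0# - 0#                                 ≈⟨ -‿inverseʳ 0# ⟩
      0#                                      ∎)

    Σ𝒦Φ-sucₙ : ∀ n m → Σ𝒦Φ (suc n) m * Pᵣ n ≈ Σ𝒦Φ n m * Q n m
    Σ𝒦Φ-sucₙ n m = x∙y⁻¹≈ε⇒x≈y _ _ (begin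
      Σ𝒦Φ (suc n) m * Pᵣ n - Σ𝒦Φ n m * Q n m
        ≈⟨ +-congˡ (-‿cong (*-cong (Σ𝒦Φ-as-sucₙ n m) (Q≈Q′ n m))) ⟩
      Σ𝒦Φ (suc n) m * Pᵣ n - sumTo (suc n) (λ r → sumTo m (λ s → t r s * k r)) * Q′ (suc n) m
        ≈⟨ +-cong (sum-*ʳ (suc n) _ _) (-‿cong (sum-*ʳ (suc n) _ _)) ⟨
      sumTo (suc n) (λ r → sumTo m (t r) * Pᵣ n) - sumTo (suc n) (λ r → sumTo m (λ s → t r s * k r) * Q′ (suc n) m)
        ≈⟨ sum-- (suc n) _ _ ⟨
      sumTo (suc n) (λ r → sumTo m (t r) * Pᵣ n - sumTo m (λ s → t r s * k r) * Q′ (suc n) m)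
        ≈⟨ sum-cong (suc n) (λ r _ → +-cong (sum-*ʳ m _ _) (-‿cong (sum-*ʳ m _ _))) ⟨
      sumTo (suc n) (λ r → sumTo m (λ s → t r s * Pᵣ n) - sumTo m (λ s → t r s * k r * Q′ (suc n) m))
        ≈⟨ sum-cong (suc n) (λ r _ → trans (sym (sum-- m _ _)) (sum-cong m (λ s _ → pointwise r s))) ⟩
      sumTo (suc n) (λ r → sumTo m (λ s → (A (suc n) m r s - B (suc n) m r s) + (C (suc n) m r s - D (suc n) m r s)))
        ≈⟨ trans (sum-cong (suc n) (λ r _ → sum-+ m _ _)) (sum-+ (suc n) _ _) ⟩
      sumTo (suc n) (λ r → sumTo m (λ s → A (suc n) m r s - B (suc n) m r s))
        + sumTo (suc n) (λ r → sumTo m (λ s → C (suc n) m r s - D (suc n) m r s))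
        ≈⟨ +-cong (ΣA-B≈0 n m) (ΣC-D≈0 (suc n) m) ⟩
      0# + 0#
        ≈⟨ +-identityˡ 0# ⟩
      0# ∎)
      where
      t : ℕ → ℕ → Carrier
      t = 𝒦Φ (suc n) m
      k : ℕ → Carrier
      k r = (q ^ r - q ^ suc n) * (q ^ r) ⁻¹
      pointwise : ∀ r s → t r s * Pᵣ n - t r s * k r * Q′ (suc n) m
                        ≈ (A (suc n) m r s - B (suc n) m r s) + (C (suc n) m r s - D (suc n) m r s)
      pointwise r s = trans (solve 4 (λ t p k Q → t :* p :- t :* k :* Q := t :* (p :- Q :* k)) refl (t r s) (Pᵣ n) (k r) (Q′ (suc n) m))
                            (certificate n m r s)

    Σ𝒦Φ-step : ∀ n m → Σ𝒦Φ n m ≈ Φ z w q n m → Σ𝒦Φ (suc n) m ≈ Φ z w q (suc n) m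
    Σ𝒦Φ-step n m ih = *-cancelʳ Pᵣ≉0 (begin
      Σ𝒦Φ (suc n) m * Pᵣ n     ≈⟨ Σ𝒦Φ-sucₙ n m ⟩
      Σ𝒦Φ n m * Q n m          ≈⟨ *-congʳ ih ⟩
      Φ z w q n m * Q n m      ≈⟨ Φ-sucₙ n m ⟨
      Φ z w q (suc n) m * Pᵣ n ∎)
      where
      Pᵣ≉0 : NonZero (Pᵣ n)
      Pᵣ≉0 = *-nonZero (*-nonZero (1-qqʲ≉0 n) (1-zqqʲ≉0 n)) (1-zwqqʲ≉0 n)

    Σ𝒦Φ-at-0 : Σ𝒦Φ 0 0 ≈ Φ z w q 0 0
    Σ𝒦Φ-at-0 = begin
      1# * 1# * 1# * (1# * 1#) ⁻¹ * Φ z w q 0 0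
        ≈⟨ *-congʳ (*-congˡ (⁻¹-≈1 (*-identityˡ 1#))) ⟩
      1# * 1# * 1# * 1# * Φ z w q 0 0
        ≈⟨ solve 1 (λ φ → 𝟙 :* 𝟙 :* 𝟙 :* 𝟙 :* φ := φ) refl (Φ z w q 0 0) ⟩
      Φ z w q 0 0 ∎

    Σ𝒦Φ-column : ∀ n → Σ𝒦Φ n 0 ≈ Φ z w q n 0
    Σ𝒦Φ-column zero    = Σ𝒦Φ-at-0
    Σ𝒦Φ-column (suc n) = Σ𝒦Φ-step n 0 (Σ𝒦Φ-column n)

  module _ {z w q : Carrier} (q≉0 : NonZero q)
    (1-qqʲ≉0 : ∀ j → NonZero (1# - q * q ^ j))
    (1-zqqʲ≉0 : ∀ j → NonZero (1# - z * q * q ^ j))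
    (1-wqqʲ≉0 : ∀ j → NonZero (1# - w * q * q ^ j))
    (1-zwqqʲ≉0 : ∀ j → NonZero (1# - z * w * q * q ^ j)) where

    private
      zwq≈wzq : z * w * q ≈ w * z * q
      zwq≈wzq = *-congʳ (*-comm z w)

      module ZW = Recurrence z w q q≉0 1-qqʲ≉0 1-zqqʲ≉0 1-wqqʲ≉0 1-zwqqʲ≉0
      module WZ = Recurrence w z q q≉0 1-qqʲ≉0 1-wqqʲ≉0 1-zqqʲ≉0
                    (λ j → ≈-nonZero (+-congˡ (-‿cong (*-congʳ zwq≈wzq))) (1-zwqqʲ≉0 j))

      Φ-comm : ∀ r s → Φ z w q r s ≈ Φ w z q s r
      Φ-comm r s = *-cong
        (trans (poch-cong q (r ℕ.+ s) zwq≈wzq) (reflexive (≡.cong (poch (w * z * q) q) (ℕ.+-comm r s))))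
        (⁻¹-cong (ZW.Φden-nonZero r s)
          (trans (*-comm _ _) (*-cong (*-congˡ (poch-cong q s zwq≈wzq)) (*-congˡ (poch-cong q r zwq≈wzq)))))

      𝒦-comm : ∀ n m r s → 𝒦 z w q n m r s ≈ 𝒦 w z q m n s r
      𝒦-comm n m r s = *-cong
        (*-cong (*-comm (z ^ r) (w ^ s)) (reflexive (≡.cong (q ^_) (quadratic-comm r s))))
        (⁻¹-cong (ZW.𝒦den-nonZero n m r s) (*-comm _ _))

    𝒦Φ-sum : ∀ n m → sumTo n (λ r → sumTo m (λ s → 𝒦 z w q n m r s * Φ z w q r s)) ≈ Φ z w q n m
    𝒦Φ-sum zero m = begin
      sumTo m (λ s → 𝒦 z w q 0 m 0 s * Φ z w q 0 s)   ≈⟨ sum-cong m (λ s _ → *-cong (𝒦-comm 0 m 0 s) (Φ-comm 0 s)) ⟩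
      WZ.Σ𝒦Φ m 0                                       ≈⟨ WZ.Σ𝒦Φ-column m ⟩
      Φ w z q m 0                                      ≈⟨ Φ-comm 0 m ⟨
      Φ z w q 0 m                                      ∎
    𝒦Φ-sum (suc n) m = ZW.Σ𝒦Φ-step n m (𝒦Φ-sum n m)

module Theorem {c ℓ} (F : Field c ℓ) where

  open import Data.Nat.Base as ℕ using (ℕ; zero; suc; _<_; z<s)
  import Data.Nat.Properties as ℕ
  import Relation.Binary.PropositionalEquality as ≡
  open Field F hiding (zero)
  open FieldDefs F
  open import Relation.Binary.Reasoning.Setoid setoid
  open IntegerRingSolver commutativeRing using (solve; _:=_; _:*_; _:+_; _:-_; 𝟙; 𝟘)
  open FieldProperties F
  open QuadraticExponent
  open 𝒦ΦSum F

  module _ {q : Carrier} (q≉0 : NonZero q) where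

    private
      q⁻¹ : Carrier
      q⁻¹ = q ⁻¹

      q*q⁻¹≈1 : q * q⁻¹ ≈ 1#
      q*q⁻¹≈1 = ⁻¹-inverseʳ q≉0

      q⁻¹ᵏqᵏ≈1 : ∀ k → q⁻¹ ^ k * q ^ k ≈ 1#
      q⁻¹ᵏqᵏ≈1 k = trans (sym (^-distribʳ-* q⁻¹ q k)) (trans (^-cong k (trans (*-comm q⁻¹ q) q*q⁻¹≈1)) (1^n≈1 k))

      qʳ≉0 : ∀ k → NonZero (q ^ k)
      qʳ≉0 k = ^-nonZero k q≉0

    𝒦-z/q-sucᵣ : ∀ z w n′ m r s → 𝒦 (z / q) w q (suc n′) m (suc r) s ≈ z * 𝒦 (z * q) (w / q) q n′ m r s
    𝒦-z/q-sucᵣ z w n′ m r s = trans (*-congʳ numerator) (*-assoc _ _ _)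
      where
      d : Carrier
      d = q ^ s * q * q ^ r
      d≉0 : NonZero d
      d≉0 = *-nonZero (*-nonZero (qʳ≉0 s) q≉0) (qʳ≉0 r)
      numerator : (z * q⁻¹) * (z * q⁻¹) ^ r * w ^ s * q ^ quadratic (suc r) s ≈ z * ((z * q) ^ r * (w * q⁻¹) ^ s * q ^ quadratic r s)
      numerator = *-cancelʳ d≉0 (begin
        (z * q⁻¹) * (z * q⁻¹) ^ r * w ^ s * q ^ quadratic (suc r) s * d ≈⟨ *-congʳ (*-congʳ (*-congʳ (*-congˡ (^-distribʳ-* z q⁻¹ r)))) ⟩
        (z * q⁻¹) * (z ^ r * q⁻¹ ^ r) * w ^ s * q ^ quadratic (suc r) s * d
          ≈⟨ solve 9 (λ z i zr ir ws e1 qs q qr → (z :* i) :* (zr :* ir) :* ws :* e1 :* (qs :* q :* qr) := (z :* zr :* ws) :* (e1 :* qs) :* (q :* i) :* (ir :* qr))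
               refl z q⁻¹ (z ^ r) (q⁻¹ ^ r) (w ^ s) (q ^ quadratic (suc r) s) (q ^ s) q (q ^ r) ⟩
        (z * z ^ r * w ^ s) * (q ^ quadratic (suc r) s * q ^ s) * (q * q⁻¹) * (q⁻¹ ^ r * q ^ r)
          ≈⟨ *-cong (*-cong (*-congˡ (q^quadratic-sucˡ q r s)) q*q⁻¹≈1) (q⁻¹ᵏqᵏ≈1 r) ⟩
        (z * z ^ r * w ^ s) * (q ^ quadratic r s * (q * (q ^ r * q ^ r))) * 1# * 1#
          ≈⟨ solve 2 (λ a b → a :* b :* 𝟙 :* 𝟙 := a :* b :* 𝟙) refl (z * z ^ r * w ^ s) (q ^ quadratic r s * (q * (q ^ r * q ^ r))) ⟩
        (z * z ^ r * w ^ s) * (q ^ quadratic r s * (q * (q ^ r * q ^ r))) * 1# ≈⟨ *-congˡ (sym (q⁻¹ᵏqᵏ≈1 s)) ⟩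
        (z * z ^ r * w ^ s) * (q ^ quadratic r s * (q * (q ^ r * q ^ r))) * (q⁻¹ ^ s * q ^ s)
          ≈⟨ solve 8 (λ z zr qr ws is e0 qs q → (z :* zr :* ws) :* (e0 :* (q :* (qr :* qr))) :* (is :* qs) := z :* ((zr :* qr) :* (ws :* is) :* e0) :* (qs :* q :* qr))
               refl z (z ^ r) (q ^ r) (w ^ s) (q⁻¹ ^ s) (q ^ quadratic r s) (q ^ s) q ⟩
        z * ((z ^ r * q ^ r) * (w ^ s * q⁻¹ ^ s) * q ^ quadratic r s) * d ≈⟨ *-congʳ (*-congˡ (*-congʳ (sym (*-cong (^-distribʳ-* z q r) (^-distribʳ-* w q⁻¹ s))))) ⟩
        z * ((z * q) ^ r * (w * q⁻¹) ^ s * q ^ quadratic r s) * d ∎)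

    𝒦-z/q-suc : ∀ z w n′ m′ r s → 𝒦 (z / q) w q (suc n′) (suc m′) (suc r) (suc s) ≈ z * w * 𝒦 z (w * q) q n′ m′ r s
    𝒦-z/q-suc z w n′ m′ r s = trans (*-congʳ numerator) (*-assoc _ _ _)
      where
      numerator : (z * q⁻¹) * (z * q⁻¹) ^ r * (w * w ^ s) * q ^ quadratic (suc r) (suc s) ≈ z * w * (z ^ r * (w * q) ^ s * q ^ quadratic r s)
      numerator = begin
        (z * q⁻¹) * (z * q⁻¹) ^ r * (w * w ^ s) * q ^ quadratic (suc r) (suc s) ≈⟨ *-cong (*-congʳ (*-congˡ (^-distribʳ-* z q⁻¹ r))) (q^quadratic-suc q r s) ⟩
        (z * q⁻¹) * (z ^ r * q⁻¹ ^ r) * (w * w ^ s) * (q ^ quadratic r s * (q * (q ^ r * q ^ s)))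
          ≈⟨ solve 10 (λ z i zr ir w ws e0 q qr qs → (z :* i) :* (zr :* ir) :* (w :* ws) :* (e0 :* (q :* (qr :* qs))) := (z :* w :* (zr :* (ws :* qs) :* e0)) :* (q :* i) :* (ir :* qr))
               refl z q⁻¹ (z ^ r) (q⁻¹ ^ r) w (w ^ s) (q ^ quadratic r s) q (q ^ r) (q ^ s) ⟩
        (z * w * (z ^ r * (w ^ s * q ^ s) * q ^ quadratic r s)) * (q * q⁻¹) * (q⁻¹ ^ r * q ^ r) ≈⟨ *-cong (*-congˡ q*q⁻¹≈1) (q⁻¹ᵏqᵏ≈1 r) ⟩
        (z * w * (z ^ r * (w ^ s * q ^ s) * q ^ quadratic r s)) * 1# * 1# ≈⟨ solve 1 (λ a → a :* 𝟙 :* 𝟙 := a) refl (z * w * (z ^ r * (w ^ s * q ^ s) * q ^ quadratic r s)) ⟩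
        z * w * (z ^ r * (w ^ s * q ^ s) * q ^ quadratic r s) ≈⟨ *-congˡ (*-congʳ (*-congˡ (sym (^-distribʳ-* w q s)))) ⟩
        z * w * (z ^ r * (w * q) ^ s * q ^ quadratic r s) ∎


  module _ {z w q : Carrier} (q≉0 : NonZero q)
    (1-zᵃwᵇqʲ≉0 : ∀ a b j → 0 < a ℕ.+ b ℕ.+ j → NonZero (1# - z ^ a * w ^ b * q ^ j)) where

    private
      q⁻¹ : Carrier
      q⁻¹ = q ⁻¹

      q*q⁻¹≈1 : q * q⁻¹ ≈ 1#
      q*q⁻¹≈1 = ⁻¹-inverseʳ q≉0

    1-monomial≉0 : ∀ a b k → 0 < a ℕ.+ b ℕ.+ k → ∀ {x} → x ≈ z ^ a * w ^ b * q ^ k → NonZero (1# - x)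
    1-monomial≉0 a b k pos x≈ = ≈-nonZero (+-congˡ (-‿cong (sym x≈))) (1-zᵃwᵇqʲ≉0 a b k pos)

    1-monomial·qʲ≉0 : ∀ a b k → 0 < a ℕ.+ b ℕ.+ k → ∀ {x} → x ≈ z ^ a * w ^ b * q ^ k → ∀ j → NonZero (1# - x * q ^ j)
    1-monomial·qʲ≉0 a b k pos {x} x≈ j = 1-monomial≉0 a b (k ℕ.+ j) pos′ (begin
      x * q ^ j                          ≈⟨ *-congʳ x≈ ⟩
      z ^ a * w ^ b * q ^ k * q ^ j      ≈⟨ *-assoc _ _ _ ⟩
      z ^ a * w ^ b * (q ^ k * q ^ j)    ≈⟨ *-congˡ (^-+ q k j) ⟨
      z ^ a * w ^ b * q ^ (k ℕ.+ j)      ∎)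
      where pos′ = ℕ.≤-trans pos (ℕ.+-monoʳ-≤ (a ℕ.+ b) (ℕ.m≤m+n k j))

    poch-monomial≉0 : ∀ a b k → 0 < a ℕ.+ b ℕ.+ k → ∀ {x} → x ≈ z ^ a * w ^ b * q ^ k → ∀ n → NonZero (poch x q n)
    poch-monomial≉0 a b k pos x≈ n = poch-nonZero _ q n (1-monomial·qʲ≉0 a b k pos x≈)

    private
      z≈z¹w⁰q⁰ : z ≈ z ^ 1 * w ^ 0 * q ^ 0
      z≈z¹w⁰q⁰ = solve 1 (λ z → z := z :* 𝟙 :* 𝟙 :* 𝟙) refl z
      w≈z⁰w¹q⁰ : w ≈ z ^ 0 * w ^ 1 * q ^ 0
      w≈z⁰w¹q⁰ = solve 1 (λ w → w := 𝟙 :* (w :* 𝟙) :* 𝟙) refl w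
      zw≈z¹w¹q⁰ : z * w ≈ z ^ 1 * w ^ 1 * q ^ 0
      zw≈z¹w¹q⁰ = solve 2 (λ z w → z :* w := z :* 𝟙 :* (w :* 𝟙) :* 𝟙) refl z w
      q≈z⁰w⁰q¹ : q ≈ z ^ 0 * w ^ 0 * q ^ 1
      q≈z⁰w⁰q¹ = solve 1 (λ q → q := 𝟙 :* 𝟙 :* (q :* 𝟙)) refl q
      zq≈z¹w⁰q¹ : z * q ≈ z ^ 1 * w ^ 0 * q ^ 1
      zq≈z¹w⁰q¹ = solve 2 (λ z q → z :* q := z :* 𝟙 :* 𝟙 :* (q :* 𝟙)) refl z q
      wq≈z⁰w¹q¹ : w * q ≈ z ^ 0 * w ^ 1 * q ^ 1
      wq≈z⁰w¹q¹ = solve 2 (λ w q → w :* q := 𝟙 :* (w :* 𝟙) :* (q :* 𝟙)) refl w q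
      zwq≈z¹w¹q¹ : z * w * q ≈ z ^ 1 * w ^ 1 * q ^ 1
      zwq≈z¹w¹q¹ = solve 3 (λ z w q → z :* w :* q := z :* 𝟙 :* (w :* 𝟙) :* (q :* 𝟙)) refl z w q
      zqq≈z¹w⁰q² : z * q * q ≈ z ^ 1 * w ^ 0 * q ^ 2
      zqq≈z¹w⁰q² = solve 2 (λ z q → z :* q :* q := z :* 𝟙 :* 𝟙 :* (q :* (q :* 𝟙))) refl z q
      wqq≈z⁰w¹q² : w * q * q ≈ z ^ 0 * w ^ 1 * q ^ 2
      wqq≈z⁰w¹q² = solve 2 (λ w q → w :* q :* q := 𝟙 :* (w :* 𝟙) :* (q :* (q :* 𝟙))) refl w q
      zwqq≈z¹w¹q² : z * w * q * q ≈ z ^ 1 * w ^ 1 * q ^ 2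
      zwqq≈z¹w¹q² = solve 3 (λ z w q → z :* w :* q :* q := z :* 𝟙 :* (w :* 𝟙) :* (q :* (q :* 𝟙))) refl z w q

      poch-z≉0 : ∀ n → NonZero (poch z q n)
      poch-z≉0 = poch-monomial≉0 1 0 0 z<s z≈z¹w⁰q⁰
      poch-w≉0 : ∀ n → NonZero (poch w q n)
      poch-w≉0 = poch-monomial≉0 0 1 0 z<s w≈z⁰w¹q⁰
      poch-zw≉0 : ∀ n → NonZero (poch (z * w) q n)
      poch-zw≉0 = poch-monomial≉0 1 1 0 z<s zw≈z¹w¹q⁰
      poch-q≉0 : ∀ n → NonZero (poch q q n)
      poch-q≉0 = poch-monomial≉0 0 0 1 z<s q≈z⁰w⁰q¹
      poch-zq≉0 : ∀ n → NonZero (poch (z * q) q n)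
      poch-zq≉0 = poch-monomial≉0 1 0 1 z<s zq≈z¹w⁰q¹
      poch-wq≉0 : ∀ n → NonZero (poch (w * q) q n)
      poch-wq≉0 = poch-monomial≉0 0 1 1 z<s wq≈z⁰w¹q¹
      poch-zwq≉0 : ∀ n → NonZero (poch (z * w * q) q n)
      poch-zwq≉0 = poch-monomial≉0 1 1 1 z<s zwq≈z¹w¹q¹
      poch-zqq≉0 : ∀ n → NonZero (poch (z * q * q) q n)
      poch-zqq≉0 = poch-monomial≉0 1 0 2 z<s zqq≈z¹w⁰q²
      poch-wqq≉0 : ∀ n → NonZero (poch (w * q * q) q n)
      poch-wqq≉0 = poch-monomial≉0 0 1 2 z<s wqq≈z⁰w¹q²
      poch-zwqq≉0 : ∀ n → NonZero (poch (z * w * q * q) q n)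
      poch-zwqq≉0 = poch-monomial≉0 1 1 2 z<s zwqq≈z¹w¹q²

      1-z≉0 : NonZero (1# - z)
      1-z≉0 = 1-monomial≉0 1 0 0 z<s z≈z¹w⁰q⁰
      1-w≉0 : NonZero (1# - w)
      1-w≉0 = 1-monomial≉0 0 1 0 z<s w≈z⁰w¹q⁰
      1-zw≉0 : NonZero (1# - z * w)
      1-zw≉0 = 1-monomial≉0 1 1 0 z<s zw≈z¹w¹q⁰
      1-zwqʳqˢ≉0 : ∀ r s → NonZero (1# - z * w * (q ^ r * q ^ s))
      1-zwqʳqˢ≉0 r s = 1-monomial≉0 1 1 (r ℕ.+ s) z<s
        (trans (*-congˡ (sym (^-+ q r s))) (solve 3 (λ z w Q → z :* w :* Q := z :* 𝟙 :* (w :* 𝟙) :* Q) refl z w (q ^ (r ℕ.+ s))))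

      Φden≉0 : ∀ r s → NonZero (Φden z w q r s)
      Φden≉0 r s = *-nonZero (*-nonZero (*-nonZero (poch-q≉0 r) (poch-zq≉0 r)) (poch-zwq≉0 r))
                             (*-nonZero (*-nonZero (poch-q≉0 s) (poch-wq≉0 s)) (poch-zwq≉0 s))

    Φ-z/q : ∀ r s → Φ (z / q) w q r s * ((1# - z) * (1# - z * w) * (1# - z * w * (q ^ r * q ^ s)))
               ≈ Φ z w q r s * ((1# - z * q ^ r) * (1# - z * w * q ^ r) * (1# - z * w * q ^ s))
    Φ-z/q r s = cross-multiply Φden′≉0 (Φden≉0 r s) (Φ-*-Φden (z / q) w q r s Φden′≉0) (Φ-*-Φden z w q r s (Φden≉0 r s)) cross
      where
      z/q·q≈z : z * q⁻¹ * q ≈ z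
      z/q·q≈z = ≈-*-unit q*q⁻¹≈1 (solve 3 (λ z i q → z :* i :* q := z :* (q :* i)) refl z q⁻¹ q)
      z/q·w·q≈zw : z * q⁻¹ * w * q ≈ z * w
      z/q·w·q≈zw = ≈-*-unit q*q⁻¹≈1 (solve 4 (λ z i w q → z :* i :* w :* q := z :* w :* (q :* i)) refl z q⁻¹ w q)
      Φden′ : Carrier
      Φden′ = (poch q q r * poch z q r * poch (z * w) q r) * (poch q q s * poch (w * q) q s * poch (z * w) q s)
      Φden≈Φden′ : Φden (z / q) w q r s ≈ Φden′
      Φden≈Φden′ = *-cong (*-cong (*-congˡ (poch-cong q r z/q·q≈z)) (poch-cong q r z/q·w·q≈zw)) (*-congˡ (poch-cong q s z/q·w·q≈zw))
      Φden′≉0 : NonZero (Φden (z / q) w q r s)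
      Φden′≉0 = ≈-nonZero (sym Φden≈Φden′)
        (*-nonZero (*-nonZero (*-nonZero (poch-q≉0 r) (poch-z≉0 r)) (poch-zw≉0 r))
                   (*-nonZero (*-nonZero (poch-q≉0 s) (poch-wq≉0 s)) (poch-zw≉0 s)))
      A : Carrier
      A = poch (z * w) q (r ℕ.+ s)
      Bb : Carrier
      Bb = poch (z * w * q) q (r ℕ.+ s)
      ρ1 : A * (1# - z * w * (q ^ r * q ^ s)) ≈ (1# - z * w) * Bb
      ρ1 = trans (*-congˡ (+-congˡ (-‿cong (*-congˡ (sym (^-+ q r s)))))) (poch-suc (z * w) q (r ℕ.+ s))
      cross : Φnum (z / q) w q r s * ((1# - z) * (1# - z * w) * (1# - z * w * (q ^ r * q ^ s))) * Φden z w q r s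
          ≈ Φnum z w q r s * ((1# - z * q ^ r) * (1# - z * w * q ^ r) * (1# - z * w * q ^ s)) * Φden (z / q) w q r s
      cross = begin
        Φnum (z / q) w q r s * k1 * Φden z w q r s ≈⟨ *-congʳ (*-congʳ (poch-cong q (r ℕ.+ s) z/q·w·q≈zw)) ⟩
        A * k1 * Φden z w q r s
          ≈⟨ solve 11 (λ A z w X Y Pr Pzq Pzwq Ps Pwq Qzwq →
               A :* ((𝟙 :- z) :* (𝟙 :- z :* w) :* (𝟙 :- z :* w :* (X :* Y))) :* ((Pr :* Pzq :* Pzwq) :* (Ps :* Pwq :* Qzwq))
               := (A :* (𝟙 :- z :* w :* (X :* Y))) :* ((𝟙 :- z) :* (𝟙 :- z :* w) :* ((Pr :* Pzq :* Pzwq) :* (Ps :* Pwq :* Qzwq))))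
               refl A z w (q ^ r) (q ^ s) (poch q q r) (poch (z * q) q r) (poch (z * w * q) q r) (poch q q s) (poch (w * q) q s) (poch (z * w * q) q s) ⟩
        (A * (1# - z * w * (q ^ r * q ^ s))) * W1 ≈⟨ *-congʳ ρ1 ⟩
        ((1# - z * w) * Bb) * W1
          ≈⟨ solve 9 (λ Bb z w Pr Pzq Pzwq Ps Pwq Qzwq →
               ((𝟙 :- z :* w) :* Bb) :* ((𝟙 :- z) :* (𝟙 :- z :* w) :* ((Pr :* Pzq :* Pzwq) :* (Ps :* Pwq :* Qzwq)))
               := ((𝟙 :- z) :* Pzq) :* ((𝟙 :- z :* w) :* Pzwq) :* ((𝟙 :- z :* w) :* Qzwq) :* (Bb :* Pr :* Ps :* Pwq))
               refl Bb z w (poch q q r) (poch (z * q) q r) (poch (z * w * q) q r) (poch q q s) (poch (w * q) q s) (poch (z * w * q) q s) ⟩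
        ((1# - z) * poch (z * q) q r) * ((1# - z * w) * poch (z * w * q) q r) * ((1# - z * w) * poch (z * w * q) q s) * W2
          ≈⟨ *-congʳ (*-cong (*-cong (sym (poch-suc z q r)) (sym (poch-suc (z * w) q r))) (sym (poch-suc (z * w) q s))) ⟩
        (poch z q r * (1# - z * q ^ r)) * (poch (z * w) q r * (1# - z * w * q ^ r)) * (poch (z * w) q s * (1# - z * w * q ^ s)) * W2
          ≈⟨ solve 11 (λ Bb z w X Y Pr Pz Pzw Ps Pwq Qzw →
               (Pz :* (𝟙 :- z :* X)) :* (Pzw :* (𝟙 :- z :* w :* X)) :* (Qzw :* (𝟙 :- z :* w :* Y)) :* (Bb :* Pr :* Ps :* Pwq)
               := Bb :* ((𝟙 :- z :* X) :* (𝟙 :- z :* w :* X) :* (𝟙 :- z :* w :* Y)) :* ((Pr :* Pz :* Pzw) :* (Ps :* Pwq :* Qzw)))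
               refl Bb z w (q ^ r) (q ^ s) (poch q q r) (poch z q r) (poch (z * w) q r) (poch q q s) (poch (w * q) q s) (poch (z * w) q s) ⟩
        Bb * k2 * Φden′ ≈⟨ *-congˡ (sym Φden≈Φden′) ⟩
        Φnum z w q r s * k2 * Φden (z / q) w q r s ∎
        where
        k1 : Carrier
        k1 = (1# - z) * (1# - z * w) * (1# - z * w * (q ^ r * q ^ s))
        k2 : Carrier
        k2 = (1# - z * q ^ r) * (1# - z * w * q ^ r) * (1# - z * w * q ^ s)
        W1 : Carrier
        W1 = (1# - z) * (1# - z * w) * Φden z w q r s
        W2 : Carrier
        W2 = Bb * poch q q r * poch q q s * poch (w * q) q s

    Φ-zq-w/q : ∀ r′ s → Φ (z * q) (w / q) q r′ s * ((1# - z * w * (q ^ suc r′ * q ^ s)) * (1# - w))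
               ≈ Φ z w q (suc r′) s * ((1# - q ^ suc r′) * (1# - z * q) * (1# - z * w * q ^ suc r′) * (1# - w * q ^ s))
    Φ-zq-w/q r′ s = cross-multiply Φden′≉0 (Φden≉0 (suc r′) s) (Φ-*-Φden (z * q) (w / q) q r′ s Φden′≉0) (Φ-*-Φden z w q (suc r′) s (Φden≉0 (suc r′) s)) cross
      where
      w/q·q≈w : w * q⁻¹ * q ≈ w
      w/q·q≈w = ≈-*-unit q*q⁻¹≈1 (solve 3 (λ w i q → w :* i :* q := w :* (q :* i)) refl w q⁻¹ q)
      zq·w/q·q≈zwq : z * q * (w * q⁻¹) * q ≈ z * w * q
      zq·w/q·q≈zwq = ≈-*-unit q*q⁻¹≈1 (solve 4 (λ z i w q → z :* q :* (w :* i) :* q := z :* w :* q :* (q :* i)) refl z q⁻¹ w q)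
      x : Carrier
      x = q ^ r′
      y : Carrier
      y = q ^ s
      Φden′ : Carrier
      Φden′ = (poch q q r′ * poch (z * q * q) q r′ * poch (z * w * q) q r′) * (poch q q s * poch w q s * poch (z * w * q) q s)
      Φden≈Φden′ : Φden (z * q) (w / q) q r′ s ≈ Φden′
      Φden≈Φden′ = *-cong (*-congˡ (poch-cong q r′ zq·w/q·q≈zwq)) (*-cong (*-congˡ (poch-cong q s w/q·q≈w)) (poch-cong q s zq·w/q·q≈zwq))
      Φden′≉0 : NonZero (Φden (z * q) (w / q) q r′ s)
      Φden′≉0 = ≈-nonZero (sym Φden≈Φden′)
        (*-nonZero (*-nonZero (*-nonZero (poch-q≉0 r′) (poch-zqq≉0 r′)) (poch-zwq≉0 r′))
                   (*-nonZero (*-nonZero (poch-q≉0 s) (poch-w≉0 s)) (poch-zwq≉0 s)))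
      A : Carrier
      A = poch (z * w * q) q (r′ ℕ.+ s)
      cross : Φnum (z * q) (w / q) q r′ s * ((1# - z * w * (q ^ suc r′ * q ^ s)) * (1# - w)) * Φden z w q (suc r′) s
          ≈ Φnum z w q (suc r′) s * ((1# - q ^ suc r′) * (1# - z * q) * (1# - z * w * q ^ suc r′) * (1# - w * q ^ s)) * Φden (z * q) (w / q) q r′ s
      cross = begin
        Φnum (z * q) (w / q) q r′ s * k1 * ((poch q q r′ * (1# - q * x) * poch (z * q) q (suc r′) * (poch (z * w * q) q r′ * (1# - z * w * q * x))) * sp)
          ≈⟨ *-cong (*-congʳ (poch-cong q (r′ ℕ.+ s) zq·w/q·q≈zwq)) (*-congʳ (*-congʳ (*-congˡ (poch-suc (z * q) q r′)))) ⟩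
        A * k1 * ((poch q q r′ * (1# - q * x) * ((1# - z * q) * poch (z * q * q) q r′) * (poch (z * w * q) q r′ * (1# - z * w * q * x))) * sp)
          ≈⟨ solve 12 (λ A z w q x y Pr Pzqq Pzwq Ps Pwq Qzwq →
               A :* ((𝟙 :- z :* w :* ((q :* x) :* y)) :* (𝟙 :- w)) :* ((Pr :* (𝟙 :- q :* x) :* ((𝟙 :- z :* q) :* Pzqq) :* (Pzwq :* (𝟙 :- z :* w :* q :* x))) :* (Ps :* Pwq :* Qzwq))
               := ((𝟙 :- w) :* Pwq) :* (A :* (𝟙 :- z :* w :* ((q :* x) :* y)) :* Pr :* (𝟙 :- q :* x) :* (𝟙 :- z :* q) :* Pzqq :* Pzwq :* (𝟙 :- z :* w :* q :* x) :* Ps :* Qzwq))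
               refl A z w q x y (poch q q r′) (poch (z * q * q) q r′) (poch (z * w * q) q r′) (poch q q s) (poch (w * q) q s) (poch (z * w * q) q s) ⟩
        ((1# - w) * poch (w * q) q s) * W ≈⟨ *-congʳ (sym (poch-suc w q s)) ⟩
        (poch w q s * (1# - w * y)) * W
          ≈⟨ solve 12 (λ A z w q x y Pr Pzqq Pzwq Ps Pw Qzwq →
               (Pw :* (𝟙 :- w :* y)) :* (A :* (𝟙 :- z :* w :* ((q :* x) :* y)) :* Pr :* (𝟙 :- q :* x) :* (𝟙 :- z :* q) :* Pzqq :* Pzwq :* (𝟙 :- z :* w :* q :* x) :* Ps :* Qzwq)
               := (A :* (𝟙 :- z :* w :* q :* (x :* y))) :* ((𝟙 :- q :* x) :* (𝟙 :- z :* q) :* (𝟙 :- z :* w :* (q :* x)) :* (𝟙 :- w :* y)) :* ((Pr :* Pzqq :* Pzwq) :* (Ps :* Pw :* Qzwq)))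
               refl A z w q x y (poch q q r′) (poch (z * q * q) q r′) (poch (z * w * q) q r′) (poch q q s) (poch w q s) (poch (z * w * q) q s) ⟩
        (A * (1# - z * w * q * (x * y))) * k2 * Φden′ ≈⟨ *-cong (*-congʳ (*-congˡ (+-congˡ (-‿cong (*-congˡ (sym (^-+ q r′ s))))))) (sym Φden≈Φden′) ⟩
        Φnum z w q (suc r′) s * k2 * Φden (z * q) (w / q) q r′ s ∎
        where
        k1 : Carrier
        k1 = (1# - z * w * (q ^ suc r′ * q ^ s)) * (1# - w)
        k2 : Carrier
        k2 = (1# - q ^ suc r′) * (1# - z * q) * (1# - z * w * q ^ suc r′) * (1# - w * q ^ s)
        sp : Carrier
        sp = poch q q s * poch (w * q) q s * poch (z * w * q) q s
        W : Carrier
        W = A * (1# - z * w * ((q * x) * y)) * poch q q r′ * (1# - q * x) * (1# - z * q) * poch (z * q * q) q r′ * poch (z * w * q) q r′ * (1# - z * w * q * x) * poch q q s * poch (z * w * q) q s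

    Φ-z-wq : ∀ r′ s′ → Φ z (w * q) q r′ s′ * (1# - z * w * (q ^ suc r′ * q ^ suc s′))
               ≈ Φ z w q (suc r′) (suc s′) * ((1# - q ^ suc r′) * (1# - z * q ^ suc r′) * (1# - q ^ suc s′) * (1# - w * q) * (1# - z * w * q))
    Φ-z-wq r′ s′ = cross-multiply Φden′≉0 (Φden≉0 (suc r′) (suc s′)) (Φ-*-Φden z (w * q) q r′ s′ Φden′≉0) (Φ-*-Φden z w q (suc r′) (suc s′) (Φden≉0 (suc r′) (suc s′))) cross
      where
      z·wq·q≈zwqq : z * (w * q) * q ≈ z * w * q * q
      z·wq·q≈zwqq = solve 3 (λ z w q → z :* (w :* q) :* q := z :* w :* q :* q) refl z w q
      x : Carrier
      x = q ^ r′
      y : Carrier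
      y = q ^ s′
      Φden′ : Carrier
      Φden′ = (poch q q r′ * poch (z * q) q r′ * poch (z * w * q * q) q r′) * (poch q q s′ * poch (w * q * q) q s′ * poch (z * w * q * q) q s′)
      Φden≈Φden′ : Φden z (w * q) q r′ s′ ≈ Φden′
      Φden≈Φden′ = *-cong (*-congˡ (poch-cong q r′ z·wq·q≈zwqq)) (*-congˡ (poch-cong q s′ z·wq·q≈zwqq))
      Φden′≉0 : NonZero (Φden z (w * q) q r′ s′)
      Φden′≉0 = ≈-nonZero (sym Φden≈Φden′)
        (*-nonZero (*-nonZero (*-nonZero (poch-q≉0 r′) (poch-zq≉0 r′)) (poch-zwqq≉0 r′))
                   (*-nonZero (*-nonZero (poch-q≉0 s′) (poch-wqq≉0 s′)) (poch-zwqq≉0 s′)))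
      A : Carrier
      A = poch (z * w * q * q) q (r′ ℕ.+ s′)
      Φnum-suc-suc : Φnum z w q (suc r′) (suc s′) ≈ ((1# - z * w * q) * A) * (1# - z * w * q * (q * (x * y)))
      Φnum-suc-suc = trans (reflexive (≡.cong (λ k → poch (z * w * q) q (suc k)) (ℕ.+-suc r′ s′)))
              (*-cong (poch-suc (z * w * q) q (r′ ℕ.+ s′)) (+-congˡ (-‿cong (*-congˡ (*-congˡ (^-+ q r′ s′))))))
      cross : Φnum z (w * q) q r′ s′ * (1# - z * w * (q ^ suc r′ * q ^ suc s′)) * Φden z w q (suc r′) (suc s′)
          ≈ Φnum z w q (suc r′) (suc s′) * ((1# - q ^ suc r′) * (1# - z * q ^ suc r′) * (1# - q ^ suc s′) * (1# - w * q) * (1# - z * w * q)) * Φden z (w * q) q r′ s′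
      cross = begin
        Φnum z (w * q) q r′ s′ * k1 * ((poch q q r′ * (1# - q * x) * (poch (z * q) q r′ * (1# - z * q * x)) * poch (z * w * q) q (suc r′))
                                     * (poch q q s′ * (1# - q * y) * poch (w * q) q (suc s′) * poch (z * w * q) q (suc s′)))
          ≈⟨ *-cong (*-congʳ (poch-cong q (r′ ℕ.+ s′) z·wq·q≈zwqq))
                    (*-cong (*-congˡ (poch-suc (z * w * q) q r′)) (*-cong (*-congˡ (poch-suc (w * q) q s′)) (poch-suc (z * w * q) q s′))) ⟩
        A * k1 * ((poch q q r′ * (1# - q * x) * (poch (z * q) q r′ * (1# - z * q * x)) * ((1# - z * w * q) * poch (z * w * q * q) q r′))
                   * (poch q q s′ * (1# - q * y) * ((1# - w * q) * poch (w * q * q) q s′) * ((1# - z * w * q) * poch (z * w * q * q) q s′)))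
          ≈⟨ solve 12 (λ A z w q x y Pr Pzq Pr3 Ps Pw2 Ps3 →
               A :* (𝟙 :- z :* w :* ((q :* x) :* (q :* y))) :* ((Pr :* (𝟙 :- q :* x) :* (Pzq :* (𝟙 :- z :* q :* x)) :* ((𝟙 :- z :* w :* q) :* Pr3))
                   :* (Ps :* (𝟙 :- q :* y) :* ((𝟙 :- w :* q) :* Pw2) :* ((𝟙 :- z :* w :* q) :* Ps3)))
               := (((𝟙 :- z :* w :* q) :* A) :* (𝟙 :- z :* w :* q :* (q :* (x :* y))))
                 :* ((𝟙 :- q :* x) :* (𝟙 :- z :* (q :* x)) :* (𝟙 :- q :* y) :* (𝟙 :- w :* q) :* (𝟙 :- z :* w :* q))
                 :* ((Pr :* Pzq :* Pr3) :* (Ps :* Pw2 :* Ps3)))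
               refl A z w q x y (poch q q r′) (poch (z * q) q r′) (poch (z * w * q * q) q r′) (poch q q s′) (poch (w * q * q) q s′) (poch (z * w * q * q) q s′) ⟩
        (((1# - z * w * q) * A) * (1# - z * w * q * (q * (x * y)))) * k2 * Φden′ ≈⟨ *-cong (*-congʳ (sym Φnum-suc-suc)) (sym Φden≈Φden′) ⟩
        Φnum z w q (suc r′) (suc s′) * k2 * Φden z (w * q) q r′ s′ ∎
        where
        k1 : Carrier
        k1 = 1# - z * w * (q ^ suc r′ * q ^ suc s′)
        k2 : Carrier
        k2 = (1# - q ^ suc r′) * (1# - z * q ^ suc r′) * (1# - q ^ suc s′) * (1# - w * q) * (1# - z * w * q)

    private
      pz pwzw c₁ c₂ : Carrier
      pz = poch z q 2
      pwzw = poch w q 2 * poch (z * w) q 2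
      c₁ = (1# * z) / pz
      c₂ = (1# * 1# * z * w ^ 2) / pwzw

      Φ-z/q-factor≉0 : ∀ r s → NonZero ((1# - z) * (1# - z * w) * (1# - z * w * (q ^ r * q ^ s)))
      Φ-z/q-factor≉0 r s = *-nonZero (*-nonZero 1-z≉0 1-zw≉0) (1-zwqʳqˢ≉0 r s)

    Φuv-1-1 : ∀ r s → Φuv 1# 1# z w q r s ≈ Φ z w q r s
    Φuv-1-1 zero s = begin
      Φ (z / q) w q 0 s - c₁ * 0# + c₂ * 0# ≈⟨ solve 3 (λ f a b → f :- a :* 𝟘 :+ b :* 𝟘 := f) refl (Φ (z / q) w q 0 s) c₁ c₂ ⟩
      Φ (z / q) w q 0 s
        ≈⟨ *-cancelʳ (Φ-z/q-factor≉0 0 s) (trans (Φ-z/q 0 s) (*-congˡ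
             (solve 3 (λ z w y → (𝟙 :- z :* 𝟙) :* (𝟙 :- z :* w :* 𝟙) :* (𝟙 :- z :* w :* y) := (𝟙 :- z) :* (𝟙 :- z :* w) :* (𝟙 :- z :* w :* (𝟙 :* y)))
                refl z w (q ^ s)))) ⟩
      Φ z w q 0 s ∎
    Φuv-1-1 (suc r′) zero = *-cancelʳ Δ≉0 (begin
      (Φ1 - c₁ * Φb + c₂ * 0#) * Δ ≈⟨ solve 7 (λ f a g b k1 l2 p → (f :- a :* g :+ b :* 𝟘) :* (k1 :* l2 :* p) := f :* k1 :* (l2 :* p) :- (a :* p) :* (g :* l2) :* k1)
                                         refl Φ1 c₁ Φb c₂ k1 l2 pz ⟩
      Φ1 * k1 * (l2 * pz) - (c₁ * pz) * (Φb * l2) * k1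
        ≈⟨ +-cong (*-congʳ (Φ-z/q (suc r′) 0)) (-‿cong (*-congʳ (*-cong (/-*-cancelʳ (1# * z) (poch-z≉0 2)) (Φ-zq-w/q r′ 0)))) ⟩
      Φ0 * k2 * (l2 * pz) - (1# * z) * (Φ0 * m2) * k1
        ≈⟨ solve 5 (λ f z w q x →
             f :* ((𝟙 :- z :* (q :* x)) :* (𝟙 :- z :* w :* (q :* x)) :* (𝟙 :- z :* w :* 𝟙)) :* (((𝟙 :- z :* w :* ((q :* x) :* 𝟙)) :* (𝟙 :- w)) :* ((𝟙 :* (𝟙 :- z :* 𝟙)) :* (𝟙 :- z :* (q :* 𝟙))))
             :- (𝟙 :* z) :* (f :* ((𝟙 :- q :* x) :* (𝟙 :- z :* q) :* (𝟙 :- z :* w :* (q :* x)) :* (𝟙 :- w :* 𝟙))) :* ((𝟙 :- z) :* (𝟙 :- z :* w) :* (𝟙 :- z :* w :* ((q :* x) :* 𝟙)))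
             := f :* (((𝟙 :- z) :* (𝟙 :- z :* w) :* (𝟙 :- z :* w :* ((q :* x) :* 𝟙))) :* ((𝟙 :- z :* w :* ((q :* x) :* 𝟙)) :* (𝟙 :- w)) :* ((𝟙 :* (𝟙 :- z :* 𝟙)) :* (𝟙 :- z :* (q :* 𝟙)))))
             refl Φ0 z w q (q ^ r′) ⟩
      Φ0 * Δ ∎)
      where
      Φ1 : Carrier
      Φ1 = Φ (z / q) w q (suc r′) 0
      Φb : Carrier
      Φb = Φ (z * q) (w / q) q r′ 0
      Φ0 : Carrier
      Φ0 = Φ z w q (suc r′) 0
      k1 : Carrier
      k1 = (1# - z) * (1# - z * w) * (1# - z * w * (q ^ suc r′ * q ^ 0))
      k2 : Carrier
      k2 = (1# - z * q ^ suc r′) * (1# - z * w * q ^ suc r′) * (1# - z * w * q ^ 0)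
      l2 : Carrier
      l2 = (1# - z * w * (q ^ suc r′ * q ^ 0)) * (1# - w)
      m2 : Carrier
      m2 = (1# - q ^ suc r′) * (1# - z * q) * (1# - z * w * q ^ suc r′) * (1# - w * q ^ 0)
      Δ : Carrier
      Δ = k1 * l2 * pz
      Δ≉0 : NonZero Δ
      Δ≉0 = *-nonZero (*-nonZero (Φ-z/q-factor≉0 (suc r′) 0) (*-nonZero (1-zwqʳqˢ≉0 (suc r′) 0) 1-w≉0)) (poch-z≉0 2)
    Φuv-1-1 (suc r′) (suc s′) = *-cancelʳ Δ≉0 (begin
      (Φ1 - c₁ * Φb + c₂ * Φc) * Δ ≈⟨ solve 10 (λ f a g b h k1 l2 l3 p pw → (f :- a :* g :+ b :* h) :* (k1 :* l2 :* l3 :* p :* pw)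
                                            := f :* k1 :* (l2 :* l3 :* p :* pw) :- (a :* p) :* (g :* l2) :* (k1 :* l3 :* pw) :+ (b :* pw) :* (h :* l3) :* (k1 :* l2 :* p))
                                         refl Φ1 c₁ Φb c₂ Φc k1 l2 l3 pz pwzw ⟩
      Φ1 * k1 * (l2 * l3 * pz * pwzw) - (c₁ * pz) * (Φb * l2) * (k1 * l3 * pwzw) + (c₂ * pwzw) * (Φc * l3) * (k1 * l2 * pz)
        ≈⟨ +-cong (+-cong (*-congʳ (Φ-z/q (suc r′) (suc s′))) (-‿cong (*-congʳ (*-cong (/-*-cancelʳ (1# * z) (poch-z≉0 2)) (Φ-zq-w/q r′ (suc s′))))))
                  (*-congʳ (*-cong (/-*-cancelʳ (1# * 1# * z * w ^ 2) (*-nonZero (poch-w≉0 2) (poch-zw≉0 2))) (Φ-z-wq r′ s′))) ⟩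
      Φ0 * k2 * (l2 * l3 * pz * pwzw) - (1# * z) * (Φ0 * m2) * (k1 * l3 * pwzw) + (1# * 1# * z * w ^ 2) * (Φ0 * m3) * (k1 * l2 * pz)
        ≈⟨ solve 6 (λ f z w q x y →
             let X = q :* x ; Y = q :* y
                 k1 = (𝟙 :- z) :* (𝟙 :- z :* w) :* (𝟙 :- z :* w :* (X :* Y))
                 k2 = (𝟙 :- z :* X) :* (𝟙 :- z :* w :* X) :* (𝟙 :- z :* w :* Y)
                 l2 = (𝟙 :- z :* w :* (X :* Y)) :* (𝟙 :- w)
                 m2 = (𝟙 :- X) :* (𝟙 :- z :* q) :* (𝟙 :- z :* w :* X) :* (𝟙 :- w :* Y)
                 l3 = 𝟙 :- z :* w :* (X :* Y)
                 m3 = (𝟙 :- X) :* (𝟙 :- z :* X) :* (𝟙 :- Y) :* (𝟙 :- w :* q) :* (𝟙 :- z :* w :* q)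
                 p = (𝟙 :* (𝟙 :- z :* 𝟙)) :* (𝟙 :- z :* (q :* 𝟙))
                 pw = ((𝟙 :* (𝟙 :- w :* 𝟙)) :* (𝟙 :- w :* (q :* 𝟙))) :* ((𝟙 :* (𝟙 :- z :* w :* 𝟙)) :* (𝟙 :- z :* w :* (q :* 𝟙)))
             in f :* k2 :* (l2 :* l3 :* p :* pw) :- (𝟙 :* z) :* (f :* m2) :* (k1 :* l3 :* pw) :+ (𝟙 :* 𝟙 :* z :* (w :* (w :* 𝟙))) :* (f :* m3) :* (k1 :* l2 :* p)
                := f :* (k1 :* l2 :* l3 :* p :* pw))
             refl Φ0 z w q (q ^ r′) (q ^ s′) ⟩
      Φ0 * Δ ∎)
      where
      Φ1 : Carrier
      Φ1 = Φ (z / q) w q (suc r′) (suc s′)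
      Φb : Carrier
      Φb = Φ (z * q) (w / q) q r′ (suc s′)
      Φc : Carrier
      Φc = Φ z (w * q) q r′ s′
      Φ0 : Carrier
      Φ0 = Φ z w q (suc r′) (suc s′)
      k1 : Carrier
      k1 = (1# - z) * (1# - z * w) * (1# - z * w * (q ^ suc r′ * q ^ suc s′))
      k2 : Carrier
      k2 = (1# - z * q ^ suc r′) * (1# - z * w * q ^ suc r′) * (1# - z * w * q ^ suc s′)
      l2 : Carrier
      l2 = (1# - z * w * (q ^ suc r′ * q ^ suc s′)) * (1# - w)
      m2 : Carrier
      m2 = (1# - q ^ suc r′) * (1# - z * q) * (1# - z * w * q ^ suc r′) * (1# - w * q ^ suc s′)
      l3 : Carrier
      l3 = 1# - z * w * (q ^ suc r′ * q ^ suc s′)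
      m3 : Carrier
      m3 = (1# - q ^ suc r′) * (1# - z * q ^ suc r′) * (1# - q ^ suc s′) * (1# - w * q) * (1# - z * w * q)
      Δ : Carrier
      Δ = k1 * l2 * l3 * pz * pwzw
      Δ≉0 : NonZero Δ
      Δ≉0 = *-nonZero (*-nonZero (*-nonZero (*-nonZero (Φ-z/q-factor≉0 (suc r′) (suc s′))
                                               (*-nonZero (1-zwqʳqˢ≉0 (suc r′) (suc s′)) 1-w≉0))
                                    (1-zwqʳqˢ≉0 (suc r′) (suc s′)))
                         (poch-z≉0 2))
                      (*-nonZero (poch-w≉0 2) (poch-zw≉0 2))


    private
      1-qqʲ≉0 : ∀ j → NonZero (1# - q * q ^ j)
      1-qqʲ≉0 = 1-monomial·qʲ≉0 0 0 1 z<s q≈z⁰w⁰q¹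

      Σ𝒦Φ[z,w] : ∀ n m → sumTo² n m (λ r s → 𝒦 z w q n m r s * Φ z w q r s) ≈ Φ z w q n m
      Σ𝒦Φ[z,w] = 𝒦Φ-sum q≉0 1-qqʲ≉0
        (1-monomial·qʲ≉0 1 0 1 z<s zq≈z¹w⁰q¹) (1-monomial·qʲ≉0 0 1 1 z<s wq≈z⁰w¹q¹) (1-monomial·qʲ≉0 1 1 1 z<s zwq≈z¹w¹q¹)

      Σ𝒦Φ[z/q,w] : ∀ n m → sumTo² n m (λ r s → 𝒦 (z / q) w q n m r s * Φ (z / q) w q r s) ≈ Φ (z / q) w q n m
      Σ𝒦Φ[z/q,w] = 𝒦Φ-sum q≉0 1-qqʲ≉0
        (1-monomial·qʲ≉0 1 0 0 z<s (≈-*-unit q*q⁻¹≈1 (solve 3 (λ z i q → z :* i :* q := z :* 𝟙 :* 𝟙 :* 𝟙 :* (q :* i)) refl z q⁻¹ q)))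
        (1-monomial·qʲ≉0 0 1 1 z<s wq≈z⁰w¹q¹)
        (1-monomial·qʲ≉0 1 1 0 z<s (≈-*-unit q*q⁻¹≈1 (solve 4 (λ z i w q → z :* i :* w :* q := z :* 𝟙 :* (w :* 𝟙) :* 𝟙 :* (q :* i)) refl z q⁻¹ w q)))

      Σ𝒦Φ[zq,w/q] : ∀ n m → sumTo² n m (λ r s → 𝒦 (z * q) (w / q) q n m r s * Φ (z * q) (w / q) q r s) ≈ Φ (z * q) (w / q) q n m
      Σ𝒦Φ[zq,w/q] = 𝒦Φ-sum q≉0 1-qqʲ≉0
        (1-monomial·qʲ≉0 1 0 2 z<s zqq≈z¹w⁰q²)
        (1-monomial·qʲ≉0 0 1 0 z<s (≈-*-unit q*q⁻¹≈1 (solve 3 (λ w i q → w :* i :* q := 𝟙 :* (w :* 𝟙) :* 𝟙 :* (q :* i)) refl w q⁻¹ q)))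
        (1-monomial·qʲ≉0 1 1 1 z<s (≈-*-unit q*q⁻¹≈1 (solve 4 (λ z i w q → z :* q :* (w :* i) :* q := z :* 𝟙 :* (w :* 𝟙) :* (q :* 𝟙) :* (q :* i)) refl z q⁻¹ w q)))

      Σ𝒦Φ[z,wq] : ∀ n m → sumTo² n m (λ r s → 𝒦 z (w * q) q n m r s * Φ z (w * q) q r s) ≈ Φ z (w * q) q n m
      Σ𝒦Φ[z,wq] = 𝒦Φ-sum q≉0 1-qqʲ≉0
        (1-monomial·qʲ≉0 1 0 1 z<s zq≈z¹w⁰q¹) (1-monomial·qʲ≉0 0 1 2 z<s wqq≈z⁰w¹q²)
        (1-monomial·qʲ≉0 1 1 2 z<s (solve 3 (λ z w q → z :* (w :* q) :* q := z :* 𝟙 :* (w :* 𝟙) :* (q :* (q :* 𝟙))) refl z w q))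

    Σ𝒦Φ↓₁ : ∀ n m → sumTo² n m (λ r s → 𝒦 (z / q) w q n m r s * Φ↓₁ (z * q) (w / q) q r s) ≈ z * Φ↓₁ (z * q) (w / q) q n m
    Σ𝒦Φ↓₁ zero    m = trans (sum-zero m (λ s _ → zeroʳ _)) (sym (zeroʳ z))
    Σ𝒦Φ↓₁ (suc n) m = begin
      sumTo² (suc n) m (λ r s → 𝒦 (z / q) w q (suc n) m r s * Φ↓₁ (z * q) (w / q) q r s)
        ≈⟨ sum-suc n _ ⟩
      sumTo m (λ s → 𝒦 (z / q) w q (suc n) m 0 s * 0#) + sumTo² n m (λ r s → 𝒦 (z / q) w q (suc n) m (suc r) s * Φ (z * q) (w / q) q r s)
        ≈⟨ +-cong (sum-zero m (λ s _ → zeroʳ _)) (sum-cong n (λ r _ → sum-cong m (λ s _ → shift r s))) ⟩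
      0# + sumTo² n m (λ r s → z * (𝒦 (z * q) (w / q) q n m r s * Φ (z * q) (w / q) q r s))
        ≈⟨ +-identityˡ _ ⟩
      sumTo² n m (λ r s → z * (𝒦 (z * q) (w / q) q n m r s * Φ (z * q) (w / q) q r s))
        ≈⟨ sumTo²-*ˡ n m z _ ⟩
      z * sumTo² n m (λ r s → 𝒦 (z * q) (w / q) q n m r s * Φ (z * q) (w / q) q r s)
        ≈⟨ *-congˡ (Σ𝒦Φ[zq,w/q] n m) ⟩
      z * Φ (z * q) (w / q) q n m ∎
      where
      shift : ∀ r s → 𝒦 (z / q) w q (suc n) m (suc r) s * Φ (z * q) (w / q) q r s ≈ z * (𝒦 (z * q) (w / q) q n m r s * Φ (z * q) (w / q) q r s)
      shift r s = trans (*-congʳ (𝒦-z/q-sucᵣ q≉0 z w n m r s)) (*-assoc _ _ _)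

    Σ𝒦Φ↓₂ : ∀ n m → sumTo² n m (λ r s → 𝒦 (z / q) w q n m r s * Φ↓₂ z (w * q) q r s) ≈ z * w * Φ↓₂ z (w * q) q n m
    Σ𝒦Φ↓₂ zero    m       = trans (sum-zero m (λ s _ → zeroʳ _)) (sym (zeroʳ _))
    Σ𝒦Φ↓₂ (suc n) zero    = trans (sum-zero (suc n) (λ r _ → trans (*-congˡ (Φ↓₂-at-0 r)) (zeroʳ _))) (sym (zeroʳ _))
      where
      Φ↓₂-at-0 : ∀ r → Φ↓₂ z (w * q) q r 0 ≈ 0#
      Φ↓₂-at-0 zero    = refl
      Φ↓₂-at-0 (suc r) = refl
    Σ𝒦Φ↓₂ (suc n) (suc m) = begin
      sumTo² (suc n) (suc m) (λ r s → 𝒦 (z / q) w q (suc n) (suc m) r s * Φ↓₂ z (w * q) q r s)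
        ≈⟨ sum-suc n _ ⟩
      sumTo (suc m) (λ s → 𝒦 (z / q) w q (suc n) (suc m) 0 s * 0#) + sumTo n row
        ≈⟨ +-cong (sum-zero (suc m) (λ s _ → zeroʳ _)) (sum-cong n (λ r _ → row≈ r)) ⟩
      0# + sumTo² n m (λ r s → z * w * (𝒦 z (w * q) q n m r s * Φ z (w * q) q r s))
        ≈⟨ +-identityˡ _ ⟩
      sumTo² n m (λ r s → z * w * (𝒦 z (w * q) q n m r s * Φ z (w * q) q r s))
        ≈⟨ sumTo²-*ˡ n m (z * w) _ ⟩
      z * w * sumTo² n m (λ r s → 𝒦 z (w * q) q n m r s * Φ z (w * q) q r s)
        ≈⟨ *-congˡ (Σ𝒦Φ[z,wq] n m) ⟩
      z * w * Φ z (w * q) q n m ∎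
      where
      row : ℕ → Carrier
      row r = sumTo (suc m) (λ s → 𝒦 (z / q) w q (suc n) (suc m) (suc r) s * Φ↓₂ z (w * q) q (suc r) s)
      row≈ : ∀ r → row r ≈ sumTo m (λ s → z * w * (𝒦 z (w * q) q n m r s * Φ z (w * q) q r s))
      row≈ r = begin
        row r
          ≈⟨ sum-suc m _ ⟩
        𝒦 (z / q) w q (suc n) (suc m) (suc r) 0 * 0# + sumTo m (λ s → 𝒦 (z / q) w q (suc n) (suc m) (suc r) (suc s) * Φ z (w * q) q r s)
          ≈⟨ +-cong (zeroʳ _) (sum-cong m (λ s _ → trans (*-congʳ (𝒦-z/q-suc q≉0 z w n m r s)) (*-assoc _ _ _))) ⟩
        0# + sumTo m (λ s → z * w * (𝒦 z (w * q) q n m r s * Φ z (w * q) q r s))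
          ≈⟨ +-identityˡ _ ⟩
        sumTo m (λ s → z * w * (𝒦 z (w * q) q n m r s * Φ z (w * q) q r s)) ∎

    first-identity : ∀ n m →
      sumTo n (λ r → sumTo m (λ s → 𝒦 z w q n m r s * Φuv 1# 1# z w q r s)) ≈ Φuv 1# 1# z w q n m
    first-identity n m = begin
      sumTo² n m (λ r s → 𝒦 z w q n m r s * Φuv 1# 1# z w q r s)   ≈⟨ sum-cong n (λ r _ → sum-cong m (λ s _ → *-congˡ (Φuv-1-1 r s))) ⟩
      sumTo² n m (λ r s → 𝒦 z w q n m r s * Φ z w q r s)           ≈⟨ Σ𝒦Φ[z,w] n m ⟩
      Φ z w q n m                                                   ≈⟨ Φuv-1-1 n m ⟨
      Φuv 1# 1# z w q n m                                           ∎

    second-identity : ∀ u v n m →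
      sumTo n (λ r → sumTo m (λ s → 𝒦 (z / q) w q n m r s * Φuv u v z w q r s)) ≈ Φuv (u * z) (v * w) z w q n m
    second-identity u v n m = begin
      sumTo² n m (λ r s → 𝒦′ r s * Φuv u v z w q r s)
        ≈⟨ sum-cong n (λ r _ → sum-cong m (λ s _ → solve 6 (λ k f a g b h → k :* (f :- a :* g :+ b :* h) := k :* f :- a :* (k :* g) :+ b :* (k :* h))
             refl (𝒦′ r s) (Φ (z / q) w q r s) a (Φ↓₁ (z * q) (w / q) q r s) b (Φ↓₂ z (w * q) q r s))) ⟩
      sumTo² n m (λ r s → 𝒦′ r s * Φ (z / q) w q r s - a * (𝒦′ r s * Φ↓₁ (z * q) (w / q) q r s) + b * (𝒦′ r s * Φ↓₂ z (w * q) q r s))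
        ≈⟨ sumTo²-linear n m _ _ _ a b ⟩
      sumTo² n m (λ r s → 𝒦′ r s * Φ (z / q) w q r s)
        - a * sumTo² n m (λ r s → 𝒦′ r s * Φ↓₁ (z * q) (w / q) q r s) + b * sumTo² n m (λ r s → 𝒦′ r s * Φ↓₂ z (w * q) q r s)
        ≈⟨ +-cong (+-cong (Σ𝒦Φ[z/q,w] n m) (-‿cong (*-congˡ (Σ𝒦Φ↓₁ n m)))) (*-congˡ (Σ𝒦Φ↓₂ n m)) ⟩
      Φ (z / q) w q n m - a * (z * φ₁) + b * (z * w * φ₂)
        ≈⟨ solve 9 (λ f u z v w p p′ Y Z → f :- u :* z :* p :* (z :* Y) :+ u :* v :* z :* (w :* (w :* 𝟙)) :* p′ :* (z :* w :* Z)
                                         := f :- u :* z :* z :* p :* Y :+ u :* z :* (v :* w) :* z :* (w :* (w :* 𝟙)) :* p′ :* Z)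
             refl (Φ (z / q) w q n m) u z v w (pz ⁻¹) (pwzw ⁻¹) φ₁ φ₂ ⟩
      Φuv (u * z) (v * w) z w q n m ∎
      where
      𝒦′ : ℕ → ℕ → Carrier
      𝒦′ = 𝒦 (z / q) w q n m
      a : Carrier
      a = u * z / pz
      b : Carrier
      b = u * v * z * w ^ 2 / pwzw
      φ₁ : Carrier
      φ₁ = Φ↓₁ (z * q) (w / q) q n m
      φ₂ : Carrier
      φ₂ = Φ↓₂ z (w * q) q n m

theorem4p4 : ∀ {c ℓ : Level} (F : Field c ℓ) →
    let open Field F
        open FieldDefs F
    in (u v z w q : Carrier) →
       ¬ (q ≈ 0#) →
       (∀ (a b j : ℕ) → 0 < a +ℕ b +ℕ j → ¬ (1# - z ^ a * w ^ b * q ^ j ≈ 0#)) →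
       (n m : ℕ) →
       (sumTo n (λ r → sumTo m (λ s → 𝒦 z w q n m r s * Φuv 1# 1# z w q r s))
          ≈ Φuv 1# 1# z w q n m)
       × (sumTo n (λ r → sumTo m (λ s → 𝒦 (z / q) w q n m r s * Φuv u v z w q r s))
          ≈ Φuv (u * z) (v * w) z w q n m)
theorem4p4 F u v z w q q≉0 1-zᵃwᵇqʲ≉0 n m =
  first-identity q≉0 1-zᵃwᵇqʲ≉0 n m , second-identity q≉0 1-zᵃwᵇqʲ≉0 u v n m
  where open Theorem F
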